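{- Let $G$ be the incidence graph of an affine plane of order $k$ with $k \ge 3$. Then $\zeta(G) = k$.
   Context: An affine plane of order $k$ is a $\mathrm{BIBD}(k^2,k^2+k,k+1,k,1)$, i.e. a set $X$ of $k^2$ points with a collection of $k^2+k$ blocks of size $k$ such that every point lies in $k+1$ blocks and every pair of distinct points lies in exactly one block, whose blocks partition into parallel classes (sets of $k$ pairwise disjoint blocks covering $X$). Its incidence graph is the bipartite graph on $X \cup \mathcal{B}$ with $x \sim B$ iff $x \in B$. Localization game on a connected graph $G$ with $k$ cops: the robber chooses a starting vertex, invisible to the cops. Each round the cops choose any $k$ vertices (no adjacency restriction) and each learns its distance to the robber; the cops win if after finitely many rounds they determine the robber's vertex uniquely; otherwise the robber moves to a neighbour or stays. The robber knows the cops' strategy. $\zeta(G)$ is the least $k$ for which $k$ cops can guarantee capture. -}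

module Defs where

open import Data.Nat using (ℕ; zero; suc; _+_; _*_; _<_; _≟_)
open import Data.Bool using (Bool; true; false; _∧_; _∨_; if_then_else_)
open import Data.Fin using (Fin; splitAt) renaming (zero to fzero; suc to fsuc; _≟_ to _≟ᶠ_)
open import Data.Fin.Properties using ()
open import Data.Sum using (_⊎_; inj₁; inj₂)
open import Data.Product using (Σ; ∃; _×_; _,_)
open import Data.Vec using (Vec; map)
open import Data.List using (List; []; _∷_)
open import Relation.Nullary using (¬_)
open import Relation.Nullary.Decidable using (⌊_⌋)
open import Relation.Binary.PropositionalEquality using (_≡_; _≢_)

count : {n : ℕ} → (Fin n → Bool) → ℕ
count {zero}  f = 0
count {suc n} f = (if f fzero then 1 else 0) + count (λ i → f (fsuc i))

anyFin : {n : ℕ} → (Fin n → Bool) → Bool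
anyFin {zero}  f = false
anyFin {suc n} f = f fzero ∨ anyFin (λ i → f (fsuc i))

record Graph (n : ℕ) : Set where
  field
    adj       : Fin n → Fin n → Bool
    symmetric : ∀ u v → adj u v ≡ adj v u
    irreflexive : ∀ u → adj u u ≡ false
open Graph public

reach : {n : ℕ} → Graph n → ℕ → Fin n → Fin n → Bool
reach G zero    u v = ⌊ u ≟ᶠ v ⌋
reach G (suc d) u v = reach G d u v ∨ anyFin (λ w → reach G d u w ∧ adj G w v)

-- least d in [i, i + fuel] with reach G d u v; returns i + fuel if none
searchDist : {n : ℕ} → Graph n → Fin n → Fin n → ℕ → ℕ → ℕ
searchDist G u v i zero = i
searchDist G u v i (suc fuel) =
  if reach G i u v then i else searchDist G u v (suc i) fuel

-- shortest-path distance (for connected graphs every distance is < n,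
-- so searching d = 0, 1, …, n finds the true distance)
dist : {n : ℕ} → Graph n → Fin n → Fin n → ℕ
dist {n} G u v = searchDist G u v 0 n

Connected : {n : ℕ} → Graph n → Set
Connected {n} G = ∀ u v → ∃ λ d → reach G d u v ≡ true

-- observation of one round: the k distances
Obs : ℕ → Set
Obs k = Vec ℕ k

-- a (deterministic) cop strategy: from the history of observations
-- (most recent first) choose k probe vertices (no adjacency restriction)
Strategy : ℕ → ℕ → Set
Strategy n k = List (Obs k) → Vec (Fin n) k

RobberWalk : {n : ℕ} → Graph n → Set
RobberWalk {n} G =
  Σ (ℕ → Fin n) λ r → ∀ t → (r (suc t) ≡ r t) ⊎ (adj G (r t) (r (suc t)) ≡ true)

-- history of observations in rounds 0 … t-1 when cops play σ against walk r
history : {n k : ℕ} → Graph n → Strategy n k → (ℕ → Fin n) → ℕ → List (Obs k)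
history G σ r zero    = []
history G σ r (suc t) =
  map (λ c → dist G c (r t)) (σ (history G σ r t)) ∷ history G σ r t

Located : {n k : ℕ} → (G : Graph n) → Strategy n k → RobberWalk G → ℕ → Set
Located G σ (r , _) t =
  ∀ (w' : RobberWalk G) → let r' = Data.Product.proj₁ w' in
    history G σ r' (suc t) ≡ history G σ r (suc t) → r' t ≡ r t

Winning : {n k : ℕ} → (G : Graph n) → Strategy n k → Set
Winning G σ = ∀ (w : RobberWalk G) → ∃ λ t → Located G σ w t

CopsWin : {n : ℕ} → Graph n → ℕ → Set
CopsWin {n} G k = Σ (Strategy n k) λ σ → Winning G σ

ZetaIs : {n : ℕ} → Graph n → ℕ → Set
ZetaIs G k = CopsWin G k × (∀ m → m < k → ¬ CopsWin G m)

-- Affine planes of order k: BIBD(k², k²+k, k+1, k, 1), resolvable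

Point : ℕ → Set
Point k = Fin (k * k)

Block : ℕ → Set
Block k = Fin (k * k + k)

IsParallelClass : (k : ℕ) → (Point k → Block k → Bool) → (Block k → Bool) → Set
IsParallelClass k inc P =
    count P ≡ k
  × (∀ B B' → P B ≡ true → P B' ≡ true → B ≢ B' →
       ∀ x → ¬ (inc x B ≡ true × inc x B' ≡ true))
  × (∀ x → ∃ λ B → P B ≡ true × inc x B ≡ true)

record AffinePlane (k : ℕ) : Set where
  field
    inc         : Point k → Block k → Bool
    blockSize   : ∀ B → count (λ x → inc x B) ≡ k
    replication : ∀ x → count (λ B → inc x B) ≡ suc k
    pairs       : ∀ x y → x ≢ y → count (λ B → inc x B ∧ inc y B) ≡ 1
    -- the blocks partition into parallel classes: cls B is the class of B
    cls         : Block k → Fin (k * k + k)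
    classes     : ∀ i → (∃ λ B → cls B ≡ i) →
                    IsParallelClass k inc (λ B → ⌊ cls B ≟ᶠ i ⌋)
open AffinePlane public

-- incidence graph on Fin (k² + (k² + k)): first k² vertices are points,
-- the remaining k² + k are blocks
incAdj : {k : ℕ} → AffinePlane k → Fin (k * k + (k * k + k)) → Fin (k * k + (k * k + k)) → Bool
incAdj {k} A u v with splitAt (k * k) u | splitAt (k * k) v
... | inj₁ x | inj₂ B = inc A x B
... | inj₂ B | inj₁ x = inc A x B
... | inj₁ _ | inj₁ _ = false
... | inj₂ _ | inj₂ _ = false

incAdj-sym : {k : ℕ} (A : AffinePlane k) → ∀ u v → incAdj A u v ≡ incAdj A v u
incAdj-sym {k} A u v with splitAt (k * k) u | splitAt (k * k) v
... | inj₁ x | inj₂ B = Relation.Binary.PropositionalEquality.refl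
... | inj₂ B | inj₁ x = Relation.Binary.PropositionalEquality.refl
... | inj₁ _ | inj₁ _ = Relation.Binary.PropositionalEquality.refl
... | inj₂ _ | inj₂ _ = Relation.Binary.PropositionalEquality.refl

incAdj-irr : {k : ℕ} (A : AffinePlane k) → ∀ u → incAdj A u u ≡ false
incAdj-irr {k} A u with splitAt (k * k) u
... | inj₁ _ = Relation.Binary.PropositionalEquality.refl
... | inj₂ _ = Relation.Binary.PropositionalEquality.refl

IncidenceGraph : {k : ℕ} → AffinePlane k → Graph (k * k + (k * k + k))
IncidenceGraph A = record
  { adj = incAdj A ; symmetric = incAdj-sym A ; irreflexive = incAdj-irr A }

-- Against m < k cops the robber keeps two positions that no reading so far
-- separates.  At a point p each probe singles out at most one of the k + 1 lines through p,
-- so two lines through p read alike and the robber steps onto one of them.  On a line L with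
-- such a twin L' through v, a union bound over the points of L, or of L ∖ v and L' ∖ v, shows
-- that either L and L' still read alike or two distinct points of L ∪ L' do, and the robber
-- steps onto one of those.
--
-- Upper bound.  k cops track the set of candidate positions.  Probing a parallel class P pins
-- a robber on a point down to one line of P, and otherwise leaves candidate lines outside P,
-- which are then excluded one per round.  Once the candidates are points of a line L, probing
-- all of them but one, L itself and enough lines through the remaining point leaves only lines
-- through one point y of L; probing all of those but one and enough lines parallel to L leaves
-- only points of one line through y.  Twice the number of candidates, plus one when they are
-- points, drops in every round.

module Submission where

open import Defs
open import Data.Nat using (ℕ; zero; suc; pred; _+_; _*_; _∸_; _≤_; _<_; z≤n; s≤s; _≤?_; _<?_)
import Data.Nat as ℕ
open import Data.Nat.Properties
open import Data.Nat.Tactic.RingSolver using (solve-∀)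
open import Data.Bool using (Bool; true; false; _∧_; _∨_; not; if_then_else_)
import Data.Bool.Properties as Bool
open import Data.Fin using (Fin; splitAt; join; _↑ˡ_; _↑ʳ_; fromℕ<)
  renaming (zero to fzero; suc to fsuc; _≟_ to _≟ᶠ_)
open import Data.Fin.Properties
  using (splitAt-join; join-splitAt; splitAt-↑ˡ; splitAt-↑ʳ; splitAt⁻¹-↑ˡ; splitAt⁻¹-↑ʳ)
  renaming (suc-injective to fsuc-injective)
open import Data.Sum using (_⊎_; inj₁; inj₂; [_,_]′)
open import Data.Product using (Σ; ∃; _×_; _,_; proj₁; proj₂)
open import Data.Empty using (⊥; ⊥-elim)
open import Data.Unit using (⊤; tt)
open import Data.List using (List; []; _∷_; length; _++_) renaming (map to lmap)
open import Data.List.Properties using (length-map; length-++)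
open import Data.List.Membership.Propositional using (_∈_)
open import Data.List.Membership.Propositional.Properties using (∈-map⁺; ∈-++⁺ˡ; ∈-++⁺ʳ)
open import Data.List.Relation.Unary.Any using (here; there)
open import Data.Vec using (Vec; []; _∷_; map)
import Data.Vec.Properties as Vec
import Data.Vec.Relation.Unary.Any as VecAny
open import Data.Vec.Membership.Propositional using () renaming (_∈_ to _∈ᵥ_)
open import Data.Vec.Relation.Unary.All using (All; []; _∷_) renaming (map to All-map; zip to All-zip)
open import Relation.Nullary using (¬_; yes; no; Dec)
open import Relation.Nullary.Decidable using (⌊_⌋)
open import Relation.Binary.PropositionalEquality

module Counting where

  indicator : Bool → ℕ
  indicator b = if b then 1 else 0

  _≢ᵇ_ : ∀ {n} → Fin n → Fin n → Bool
  a ≢ᵇ b = not ⌊ a ≟ᶠ b ⌋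

  ⌊≟⌋-refl : ∀ {n} (a : Fin n) → ⌊ a ≟ᶠ a ⌋ ≡ true
  ⌊≟⌋-refl a with a ≟ᶠ a
  ... | yes _ = refl
  ... | no a≢a = ⊥-elim (a≢a refl)

  ⌊≟⌋-true : ∀ {n} {a b : Fin n} → ⌊ a ≟ᶠ b ⌋ ≡ true → a ≡ b
  ⌊≟⌋-true {a = a} {b} e with a ≟ᶠ b
  ... | yes a≡b = a≡b

  ⌊≟⌋-false : ∀ {n} {a b : Fin n} → a ≢ b → ⌊ a ≟ᶠ b ⌋ ≡ false
  ⌊≟⌋-false {a = a} {b} a≢b with a ≟ᶠ b
  ... | yes a≡b = ⊥-elim (a≢b a≡b)
  ... | no _ = refl

  ≢ᵇ⇒≢ : ∀ {n} {a b : Fin n} → a ≢ᵇ b ≡ true → a ≢ b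
  ≢ᵇ⇒≢ {a = a} {b} p a≡b with a ≟ᶠ b
  ... | no a≢b = a≢b a≡b

  ≢⇒≢ᵇ : ∀ {n} {a b : Fin n} → a ≢ b → a ≢ᵇ b ≡ true
  ≢⇒≢ᵇ a≢b = cong not (⌊≟⌋-false a≢b)

  ∧-true : ∀ {a b : Bool} → a ∧ b ≡ true → (a ≡ true) × (b ≡ true)
  ∧-true {true} {true} _ = refl , refl

  ∧-intro : ∀ {a b : Bool} → a ≡ true → b ≡ true → a ∧ b ≡ true
  ∧-intro refl refl = refl

  remove : ∀ {n} → Fin n → (Fin n → Bool) → Fin n → Bool
  remove j f i = f i ∧ i ≢ᵇ j

  count-cong : ∀ {n} {f g : Fin n → Bool} → (∀ i → f i ≡ g i) → count f ≡ count g
  count-cong {zero} e = refl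
  count-cong {suc n} e rewrite e fzero = cong (_ +_) (count-cong (λ i → e (fsuc i)))

  count-mono : ∀ {n} {f g : Fin n → Bool} → (∀ i → f i ≡ true → g i ≡ true) → count f ≤ count g
  count-mono {zero} f⊆g = z≤n
  count-mono {suc n} {f} {g} f⊆g with f fzero in f0 | g fzero in g0
  ... | true | true = s≤s (count-mono (λ i → f⊆g (fsuc i)))
  ... | true | false with () ← trans (sym (f⊆g fzero f0)) g0
  ... | false | true = m≤n⇒m≤1+n (count-mono (λ i → f⊆g (fsuc i)))
  ... | false | false = count-mono (λ i → f⊆g (fsuc i))

  count-split : ∀ {n} (f g : Fin n → Bool) →
    count f ≡ count (λ i → f i ∧ g i) + count (λ i → f i ∧ not (g i))
  count-split {zero} f g = refl
  count-split {suc n} f g with f fzero | g fzero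
  ... | true | true = cong suc (count-split (λ i → f (fsuc i)) (λ i → g (fsuc i)))
  ... | true | false = trans (cong suc (count-split (λ i → f (fsuc i)) (λ i → g (fsuc i)))) (sym (+-suc _ _))
  ... | false | _ = count-split (λ i → f (fsuc i)) (λ i → g (fsuc i))

  count≡0 : ∀ {n} {f : Fin n → Bool} → (∀ i → f i ≡ false) → count f ≡ 0
  count≡0 {zero} none = refl
  count≡0 {suc n} {f} none rewrite none fzero = count≡0 (λ i → none (fsuc i))

  find : ∀ {n} (f : Fin n → Bool) → (∃ λ i → f i ≡ true) ⊎ (∀ i → f i ≡ false)
  find {zero} f = inj₂ (λ ())
  find {suc n} f with f fzero in f0
  ... | true = inj₁ (fzero , f0)
  ... | false with find (λ i → f (fsuc i))
  ...   | inj₁ (i , fi) = inj₁ (fsuc i , fi)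
  ...   | inj₂ none = inj₂ λ { fzero → f0 ; (fsuc i) → none i }

  1≤count⇒∃ : ∀ {n} {f : Fin n → Bool} → 1 ≤ count f → ∃ λ i → f i ≡ true
  1≤count⇒∃ {f = f} 1≤c with find f
  ... | inj₁ found = found
  ... | inj₂ none with () ← ≤-trans 1≤c (≤-reflexive (count≡0 none))

  ⌊fsuc≟fsuc⌋ : ∀ {n} (i j : Fin n) → ⌊ fsuc i ≟ᶠ fsuc j ⌋ ≡ ⌊ i ≟ᶠ j ⌋
  ⌊fsuc≟fsuc⌋ i j with i ≟ᶠ j
  ... | yes refl = refl
  ... | no _ = refl

  count-single : ∀ {n} (f : Fin n → Bool) (j : Fin n) →
    count (λ i → f i ∧ ⌊ i ≟ᶠ j ⌋) ≡ indicator (f j)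
  count-single {suc n} f fzero with f fzero
  ... | true = cong suc (count≡0 (λ i → Bool.∧-zeroʳ (f (fsuc i))))
  ... | false = count≡0 (λ i → Bool.∧-zeroʳ (f (fsuc i)))
  count-single {suc n} f (fsuc j) with f fzero
  ... | true = trans (count-cong (λ i → cong (f (fsuc i) ∧_) (⌊fsuc≟fsuc⌋ i j))) (count-single (λ i → f (fsuc i)) j)
  ... | false = trans (count-cong (λ i → cong (f (fsuc i) ∧_) (⌊fsuc≟fsuc⌋ i j))) (count-single (λ i → f (fsuc i)) j)

  count-remove : ∀ {n} (f : Fin n → Bool) (j : Fin n) →
    count f ≡ indicator (f j) + count (remove j f)
  count-remove f j =
    trans (count-split f (λ i → ⌊ i ≟ᶠ j ⌋)) (cong (_+ count (remove j f)) (count-single f j))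

  count-remove-member : ∀ {n} (f : Fin n → Bool) {j : Fin n} → f j ≡ true →
    count f ≡ suc (count (remove j f))
  count-remove-member f {j} fj = trans (count-remove f j) (cong (λ b → indicator b + count (remove j f)) fj)

  1≤count : ∀ {n} (f : Fin n → Bool) {i} → f i ≡ true → 1 ≤ count f
  1≤count f fi = ≤-trans (s≤s z≤n) (≤-reflexive (sym (count-remove-member f fi)))

  count-≤-injection : ∀ {a b} (f : Fin a → Bool) (h : Fin b → Bool) (g : Fin a → Fin b) →
    (∀ x → f x ≡ true → h (g x) ≡ true) →
    (∀ x y → f x ≡ true → f y ≡ true → g x ≡ g y → x ≡ y) →
    count f ≤ count h
  count-≤-injection {zero} f h g maps inj = z≤n
  count-≤-injection {suc a} f h g maps inj with f fzero in f0
  ... | false = count-≤-injection (λ x → f (fsuc x)) h (λ x → g (fsuc x)) (λ x → maps (fsuc x))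
                  (λ x y fx fy e → fsuc-injective (inj (fsuc x) (fsuc y) fx fy e))
  ... | true = ≤-trans (s≤s rest) (≤-reflexive (sym (count-remove-member h (maps fzero f0))))
    where
    inj' : ∀ x y → f (fsuc x) ≡ true → f (fsuc y) ≡ true → g (fsuc x) ≡ g (fsuc y) → x ≡ y
    inj' x y fx fy e = fsuc-injective (inj (fsuc x) (fsuc y) fx fy e)
    maps' : ∀ x → f (fsuc x) ≡ true → remove (g fzero) h (g (fsuc x)) ≡ true
    maps' x fx with g (fsuc x) ≟ᶠ g fzero
    ... | yes e with () ← inj (fsuc x) fzero fx f0 e
    ... | no _ rewrite maps (fsuc x) fx = refl
    rest = count-≤-injection (λ x → f (fsuc x)) (remove (g fzero) h) (λ x → g (fsuc x)) maps' inj'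

  count≤1 : ∀ {n} (f : Fin n → Bool) → (∀ x y → f x ≡ true → f y ≡ true → x ≡ y) → count f ≤ 1
  count≤1 f unique =
    count-≤-injection f (λ _ → true) (λ _ → fzero {0}) (λ _ _ → refl) (λ x y fx fy _ → unique x y fx fy)

  count≤1-⊆-singleton : ∀ {n} (f : Fin n → Bool) w → (∀ v → f v ≡ true → v ≡ w) → count f ≤ 1
  count≤1-⊆-singleton f w ⊆w = count≤1 f (λ x y fx fy → trans (⊆w x fx) (sym (⊆w y fy)))

  2≤count⇒¬⊆-singleton : ∀ {n} (f : Fin n → Bool) w → 2 ≤ count f → ¬ (∀ v → f v ≡ true → v ≡ w)
  2≤count⇒¬⊆-singleton f w 2≤c ⊆w with ≤-trans 2≤c (count≤1-⊆-singleton f w ⊆w)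
  ... | s≤s ()

  2≤count⇒¬alone : ∀ {n} (f : Fin n → Bool) w → 2 ≤ count f →
    (f w ≡ true → ∀ v → f v ≡ true → v ≡ w) → f w ≡ false
  2≤count⇒¬alone f w 2≤c alone = by (f w) refl
    where
    by : ∀ b → f w ≡ b → f w ≡ false
    by false fw = fw
    by true fw = ⊥-elim (2≤count⇒¬⊆-singleton f w 2≤c (alone fw))

  2≤count⇒distinct : ∀ {n} (f : Fin n → Bool) → 2 ≤ count f →
    Σ (Fin n) λ x → Σ (Fin n) λ y → (x ≢ y) × (f x ≡ true) × (f y ≡ true)
  2≤count⇒distinct f 2≤c with 1≤count⇒∃ {f = f} (≤-trans (s≤s z≤n) 2≤c)
  ... | x , fx with 1≤count⇒∃ {f = remove x f} (≤-pred (≤-trans 2≤c (≤-reflexive (count-remove-member f fx))))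
  ...   | y , rem with ∧-true rem
  ...     | fy , y≢x = x , y , (λ x≡y → ≢ᵇ⇒≢ y≢x (sym x≡y)) , fx , fy

  count≤1⇒unique : ∀ {n} (f : Fin n → Bool) → count f ≤ 1 → ∀ a b → f a ≡ true → f b ≡ true → a ≡ b
  count≤1⇒unique f c≤1 a b fa fb with a ≟ᶠ b
  ... | yes a≡b = a≡b
  ... | no a≢b with ≤-trans (1≤count (remove a f) (∧-intro fb (≢⇒≢ᵇ (λ b≡a → a≢b (sym b≡a)))))
                            (≤-pred (≤-trans (≤-reflexive (sym (count-remove-member f fa))) c≤1))
  ...   | ()

  anyFin⇒∃ : ∀ {n} (f : Fin n → Bool) → anyFin f ≡ true → ∃ λ i → f i ≡ true
  anyFin⇒∃ {suc n} f any with f fzero in f0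
  ... | true = fzero , f0
  ... | false with anyFin⇒∃ (λ i → f (fsuc i)) any
  ...   | i , fi = fsuc i , fi

  anyFin-intro : ∀ {n} (f : Fin n → Bool) i → f i ≡ true → anyFin f ≡ true
  anyFin-intro f fzero fi rewrite fi = refl
  anyFin-intro f (fsuc i) fi rewrite anyFin-intro (λ j → f (fsuc j)) i fi = Bool.∨-zeroʳ (f fzero)

  anyFin-false⇒∀ : ∀ {n} (f : Fin n → Bool) → anyFin f ≡ false → ∀ i → f i ≡ false
  anyFin-false⇒∀ f none i with f i in fi
  ... | false = refl
  ... | true with () ← trans (sym (anyFin-intro f i fi)) none

  ∀⇒anyFin-false : ∀ {n} (f : Fin n → Bool) → (∀ i → f i ≡ false) → anyFin f ≡ false
  ∀⇒anyFin-false f none with anyFin f in any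
  ... | false = refl
  ... | true with anyFin⇒∃ f any
  ...   | i , fi with () ← trans (sym (none i)) fi

module UnionBound where
  open Counting

  vsum : ∀ {A : Set} {m} → (A → ℕ) → Vec A m → ℕ
  vsum w [] = 0
  vsum w (c ∷ C) = w c + vsum w C

  survives : ∀ {A : Set} {N m} → (A → Fin N → Bool) → Vec A m → Fin N → Bool
  survives bad [] x = true
  survives bad (c ∷ C) x = not (bad c x) ∧ survives bad C x

  survives⇒All : ∀ {A : Set} {N m} (bad : A → Fin N → Bool) (C : Vec A m) x →
    survives bad C x ≡ true → All (λ c → bad c x ≡ false) C
  survives⇒All bad [] x s = []
  survives⇒All bad (c ∷ C) x s with bad c x in b
  ... | false = b ∷ survives⇒All bad C x s

  union-bound : ∀ {A : Set} {N m} (D : Fin N → Bool) (bad : A → Fin N → Bool) (w : A → ℕ) (C : Vec A m) →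
    (∀ c → count (λ x → D x ∧ bad c x) ≤ w c) →
    count D ≤ count (λ x → D x ∧ survives bad C x) + vsum w C
  union-bound D bad w [] _ =
    ≤-reflexive (trans (count-cong (λ x → sym (Bool.∧-identityʳ (D x)))) (sym (+-identityʳ _)))
  union-bound D bad w (c ∷ C) bound = begin
      count D                                                     ≡⟨ count-split D (bad c) ⟩
      count (λ x → D x ∧ bad c x) + count D'                      ≤⟨ +-monoˡ-≤ (count D') (bound c) ⟩
      w c + count D'                                              ≤⟨ +-monoʳ-≤ (w c) rest ⟩
      w c + (count (λ x → D' x ∧ survives bad C x) + vsum w C)    ≡⟨ cong (λ z → w c + (z + vsum w C)) reassoc ⟩
      w c + (count (λ x → D x ∧ survives bad (c ∷ C) x) + vsum w C) ≡⟨ x+[y+z]≡y+[x+z] (w c) _ (vsum w C) ⟩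
      count (λ x → D x ∧ survives bad (c ∷ C) x) + (w c + vsum w C) ∎
    where
    open ≤-Reasoning
    D' : Fin _ → Bool
    D' x = D x ∧ not (bad c x)
    reassoc = count-cong (λ x → Bool.∧-assoc (D x) (not (bad c x)) (survives bad C x))
    D'⊆D : ∀ {c'} x → D' x ∧ bad c' x ≡ true → D x ∧ bad c' x ≡ true
    D'⊆D {c'} x p with ∧-true {D' x} p
    ... | d' , b with ∧-true {D x} d'
    ...   | d , _ = ∧-intro d b
    rest = union-bound D' bad w C (λ c' → ≤-trans (count-mono D'⊆D) (bound c'))
    x+[y+z]≡y+[x+z] : ∀ a b c → a + (b + c) ≡ b + (a + c)
    x+[y+z]≡y+[x+z] = solve-∀

  map-cong-All : ∀ {A B : Set} {m} (f g : A → B) (C : Vec A m) → All (λ c → f c ≡ g c) C → map f C ≡ map g C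
  map-cong-All f g [] [] = refl
  map-cong-All f g (c ∷ C) (p ∷ ps) = cong₂ _∷_ p (map-cong-All f g C ps)

  vsum-+ : ∀ {A : Set} {m} (w w' : A → ℕ) (C : Vec A m) → vsum (λ c → w c + w' c) C ≡ vsum w C + vsum w' C
  vsum-+ w w' [] = refl
  vsum-+ w w' (c ∷ C) rewrite vsum-+ w w' C = interchange (w c) (w' c) (vsum w C) (vsum w' C)
    where
    interchange : ∀ a b x y → a + b + (x + y) ≡ a + x + (b + y)
    interchange = solve-∀

  vsum≤length : ∀ {A : Set} {m} (w : A → ℕ) (C : Vec A m) → (∀ c → w c ≤ 1) → vsum w C ≤ m
  vsum≤length w [] w≤1 = z≤n
  vsum≤length w (c ∷ C) w≤1 = +-mono-≤ (w≤1 c) (vsum≤length w C w≤1)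

  vsum≡0 : ∀ {A : Set} {m} (w : A → ℕ) (C : Vec A m) → vsum w C ≡ 0 → All (λ c → w c ≡ 0) C
  vsum≡0 w [] e = []
  vsum≡0 w (c ∷ C) e = m+n≡0⇒m≡0 (w c) e ∷ vsum≡0 w C (m+n≡0⇒n≡0 (w c) e)

  vsum≡length : ∀ {A : Set} {m} (w : A → ℕ) (C : Vec A m) → (∀ c → w c ≤ 1) → m ≤ vsum w C →
    All (λ c → w c ≡ 1) C
  vsum≡length w [] w≤1 full = []
  vsum≡length w (c ∷ C) w≤1 full with w c in wc | w≤1 c
  ... | 1 | _ = wc ∷ vsum≡length w C w≤1 (≤-pred full)
  ... | 0 | _ = ⊥-elim (<-irrefl refl (≤-trans full (vsum≤length w C w≤1)))
  ... | suc (suc _) | s≤s ()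

  vsum-pointwise≤1 : ∀ {A : Set} {m} (w w' : A → ℕ) (C : Vec A m) → (∀ c → w c + w' c ≤ 1) →
    vsum w C + vsum w' C ≤ m
  vsum-pointwise≤1 w w' C ≤1 = subst (_≤ _) (vsum-+ w w' C) (vsum≤length (λ c → w c + w' c) C ≤1)

  marks : ∀ {A : Set} {n} → (Fin n → Bool) → (A → Fin n → Bool) → A → ℕ
  marks D bad c = indicator (anyFin (λ x → D x ∧ bad c x))

  marks≤1 : ∀ {A : Set} {n} (D : Fin n → Bool) (bad : A → Fin n → Bool) c → marks D bad c ≤ 1
  marks≤1 D bad c with anyFin (λ x → D x ∧ bad c x)
  ... | true = ≤-refl
  ... | false = z≤n

  count-bad≤marks : ∀ {A : Set} {n} (D : Fin n → Bool) (bad : A → Fin n → Bool) c →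
    (∀ x y → D x ≡ true → D y ≡ true → bad c x ≡ true → bad c y ≡ true → x ≡ y) →
    count (λ x → D x ∧ bad c x) ≤ marks D bad c
  count-bad≤marks D bad c unique with anyFin (λ x → D x ∧ bad c x) in any
  ... | true = count≤1 _ (λ x y p q → let (dx , bx) = ∧-true {D x} p ; (dy , by) = ∧-true {D y} q in unique x y dx dy bx by)
  ... | false = ≤-reflexive (count≡0 (anyFin-false⇒∀ (λ x → D x ∧ bad c x) any))

  marks≡0 : ∀ {A : Set} {n} (D : Fin n → Bool) (bad : A → Fin n → Bool) c →
    (∀ x → D x ≡ true → bad c x ≡ false) → marks D bad c ≡ 0
  marks≡0 D bad c none = cong indicator (∀⇒anyFin-false (λ x → D x ∧ bad c x) clean)
    where
    clean : ∀ x → D x ∧ bad c x ≡ false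
    clean x with D x in dx
    ... | false = refl
    ... | true = none x dx

  marks≡1⇒∃ : ∀ {A : Set} {n} (D : Fin n → Bool) (bad : A → Fin n → Bool) c →
    marks D bad c ≡ 1 → ∃ λ x → (D x ≡ true) × (bad c x ≡ true)
  marks≡1⇒∃ D bad c e with anyFin (λ x → D x ∧ bad c x) in any
  ... | true = let (x , p) = anyFin⇒∃ _ any in x , ∧-true {D x} p

  many-survivors : ∀ {A : Set} {n m} (D : Fin n → Bool) (bad : A → Fin n → Bool) (C : Vec A m) j →
    (∀ c x y → D x ≡ true → D y ≡ true → bad c x ≡ true → bad c y ≡ true → x ≡ y) →
    j + vsum (marks D bad) C ≤ count D → j ≤ count (λ x → D x ∧ survives bad C x)
  many-survivors D bad C j unique j+W≤ =
    +-cancelʳ-≤ (vsum (marks D bad) C) j _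
      (≤-trans j+W≤ (union-bound D bad (marks D bad) C (λ c → count-bad≤marks D bad c (unique c))))

module Selection where
  open Counting

  takeFirst : ∀ {n} → ℕ → (Fin n → Bool) → Fin n → Bool
  takeFirst zero f i = false
  takeFirst {suc n} (suc j) f fzero = f fzero
  takeFirst {suc n} (suc j) f (fsuc i) = takeFirst (if f fzero then j else suc j) (λ x → f (fsuc x)) i

  takeFirst-⊆ : ∀ {n} j (f : Fin n → Bool) i → takeFirst j f i ≡ true → f i ≡ true
  takeFirst-⊆ {suc n} (suc j) f fzero t = t
  takeFirst-⊆ {suc n} (suc j) f (fsuc i) t = takeFirst-⊆ (if f fzero then j else suc j) (λ x → f (fsuc x)) i t

  count-takeFirst : ∀ {n} j (f : Fin n → Bool) → j ≤ count f → count (takeFirst j f) ≡ j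
  count-takeFirst zero f _ = count≡0 {f = takeFirst zero f} (λ _ → refl)
  count-takeFirst {suc n} (suc j) f j≤c with f fzero
  ... | true = cong suc (count-takeFirst j (λ x → f (fsuc x)) (≤-pred j≤c))
  ... | false = count-takeFirst (suc j) (λ x → f (fsuc x)) j≤c

  count-takeFirst-≤ : ∀ {n} j (f : Fin n → Bool) → count (takeFirst j f) ≤ j
  count-takeFirst-≤ zero f = ≤-reflexive (count≡0 {f = takeFirst zero f} (λ _ → refl))
  count-takeFirst-≤ {zero} (suc j) f = z≤n
  count-takeFirst-≤ {suc n} (suc j) f with f fzero
  ... | true = s≤s (count-takeFirst-≤ j (λ x → f (fsuc x)))
  ... | false = count-takeFirst-≤ (suc j) (λ x → f (fsuc x))

  takeFirst-all : ∀ {n} j (f : Fin n → Bool) → count f ≤ j → ∀ i → takeFirst j f i ≡ f i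
  takeFirst-all zero f c≤0 i with f i in fi
  ... | false = refl
  ... | true with () ← ≤-trans (1≤count f fi) c≤0
  takeFirst-all {suc n} (suc j) f c≤j fzero = refl
  takeFirst-all {suc n} (suc j) f c≤j (fsuc i) with f fzero
  ... | true = takeFirst-all j (λ x → f (fsuc x)) (≤-pred c≤j) i
  ... | false = takeFirst-all (suc j) (λ x → f (fsuc x)) c≤j i

  firstOr : ∀ {n} → Fin n → (Fin n → Bool) → Fin n
  firstOr d f with find f
  ... | inj₁ (x , _) = x
  ... | inj₂ _ = d

  firstOr-satisfies : ∀ {n} d (f : Fin n → Bool) {x} → f x ≡ true → f (firstOr d f) ≡ true
  firstOr-satisfies d f {x} fx with find f
  ... | inj₁ (_ , fy) = fy
  ... | inj₂ none with () ← trans (sym (none x)) fx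

  enumerate : ∀ {n} → (Fin n → Bool) → List (Fin n)
  enumerate {zero} f = []
  enumerate {suc n} f with f fzero
  ... | true = fzero ∷ lmap fsuc (enumerate (λ x → f (fsuc x)))
  ... | false = lmap fsuc (enumerate (λ x → f (fsuc x)))

  length-enumerate : ∀ {n} (f : Fin n → Bool) → length (enumerate f) ≡ count f
  length-enumerate {zero} f = refl
  length-enumerate {suc n} f with f fzero
  ... | true = cong suc (trans (length-map fsuc (enumerate (λ x → f (fsuc x)))) (length-enumerate (λ x → f (fsuc x))))
  ... | false = trans (length-map fsuc (enumerate (λ x → f (fsuc x)))) (length-enumerate (λ x → f (fsuc x)))

  ∈-enumerate : ∀ {n} (f : Fin n → Bool) i → f i ≡ true → i ∈ enumerate f
  ∈-enumerate {suc n} f fzero fi with f fzero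
  ... | true = here refl
  ∈-enumerate {suc n} f (fsuc i) fi with f fzero
  ... | true = there (∈-map⁺ fsuc (∈-enumerate (λ x → f (fsuc x)) i fi))
  ... | false = ∈-map⁺ fsuc (∈-enumerate (λ x → f (fsuc x)) i fi)

  padTo : ∀ {A : Set} k → List A → A → Vec A k
  padTo zero xs d = []
  padTo (suc k) [] d = d ∷ padTo k [] d
  padTo (suc k) (x ∷ xs) d = x ∷ padTo k xs d

  ∈-padTo : ∀ {A : Set} k (xs : List A) d {x} → x ∈ xs → length xs ≤ k → x ∈ᵥ padTo k xs d
  ∈-padTo (suc k) (y ∷ xs) d (here e) l = VecAny.here e
  ∈-padTo (suc k) (y ∷ xs) d (there p) l = VecAny.there (∈-padTo k xs d p (≤-pred l))

  map-≡-∈ : ∀ {A B : Set} {k} (f g : A → B) (C : Vec A k) {c} → c ∈ᵥ C → map f C ≡ map g C → f c ≡ g c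
  map-≡-∈ f g (y ∷ C) (VecAny.here refl) e = Vec.∷-injectiveˡ e
  map-≡-∈ f g (y ∷ C) (VecAny.there p) e = map-≡-∈ f g C p (Vec.∷-injectiveʳ e)

module Geometry {k : ℕ} (A : AffinePlane k) where
  open Counting

  Pt = Point k
  Bl = Block k

  _on_ : Pt → Bl → Set
  x on B = inc A x B ≡ true

  off≢on : ∀ {x y B} → inc A x B ≡ false → y on B → x ≢ y
  off≢on x∉B yB refl with () ← trans (sym x∉B) yB

  point-on : 1 ≤ k → ∀ B → ∃ λ x → x on B
  point-on 1≤k B = 1≤count⇒∃ (≤-trans 1≤k (≤-reflexive (sym (blockSize A B))))

  ∃-line-through : ∀ x y → x ≢ y → ∃ λ B → x on B × y on B
  ∃-line-through x y x≢y with 1≤count⇒∃ {f = λ B → inc A x B ∧ inc A y B} (≤-reflexive (sym (pairs A x y x≢y)))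
  ... | B , xyB = B , ∧-true xyB

  line-unique : ∀ {x y B C} → x ≢ y → x on B → y on B → x on C → y on C → B ≡ C
  line-unique {x} {y} {B} {C} x≢y xB yB xC yC =
    count≤1⇒unique (λ B → inc A x B ∧ inc A y B) (≤-reflexive (pairs A x y x≢y)) B C (∧-intro xB yB) (∧-intro xC yC)

  meet-unique : ∀ {x y B C} → x on B → y on B → x on C → y on C → B ≢ C → x ≡ y
  meet-unique {x} {y} xB yB xC yC B≢C with x ≟ᶠ y
  ... | yes x≡y = x≡y
  ... | no x≢y = ⊥-elim (B≢C (line-unique x≢y xB yB xC yC))

  meets : Bl → Bl → Bool
  meets B C = anyFin (λ x → inc A x B ∧ inc A x C)

  meets-intro : ∀ {x B C} → x on B → x on C → meets B C ≡ true
  meets-intro {x} xB xC = anyFin-intro _ x (∧-intro xB xC)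

  meets-elim : ∀ {B C} → meets B C ≡ true → ∃ λ x → x on B × x on C
  meets-elim {B} {C} m with anyFin⇒∃ (λ x → inc A x B ∧ inc A x C) m
  ... | x , xBC = x , ∧-true xBC

  ¬meets : ∀ {B C} → meets B C ≡ false → ∀ x → x on B → x on C → ⊥
  ¬meets {B} {C} m x xB xC with () ← trans (sym (anyFin-false⇒∀ _ m x)) (∧-intro xB xC)

  meets-sym : ∀ B C → meets B C ≡ meets C B
  meets-sym B C with meets B C in BC | meets C B in CB
  ... | true | true = refl
  ... | false | false = refl
  ... | true | false = let (x , xB , xC) = meets-elim BC in ⊥-elim (¬meets CB x xC xB)
  ... | false | true = let (x , xC , xB) = meets-elim CB in ⊥-elim (¬meets BC x xB xC)

  parallel : Bl → Bl → Bool
  parallel B C = ⌊ cls A B ≟ᶠ cls A C ⌋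

  private
    classOf : ∀ B → IsParallelClass k (inc A) (λ C → parallel C B)
    classOf B = classes A (cls A B) (B , refl)

  parallel-disjoint : ∀ {B C x} → cls A B ≡ cls A C → B ≢ C → x on B → x on C → ⊥
  parallel-disjoint {B} {C} {x} B∥C B≢C xB xC =
    proj₁ (proj₂ (classOf C)) B C (trans (cong (λ c → ⌊ c ≟ᶠ cls A C ⌋) B∥C) (⌊≟⌋-refl (cls A C)))
      (⌊≟⌋-refl (cls A C)) B≢C x (xB , xC)

  parallel-cover : ∀ B x → ∃ λ C → (cls A C ≡ cls A B) × x on C
  parallel-cover B x with proj₂ (proj₂ (classOf B)) x
  ... | C , C∥B , xC = C , ⌊≟⌋-true C∥B , xC

  class-size : ∀ B → count (λ C → parallel C B) ≡ k
  class-size B = proj₁ (classOf B)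

  -- an arbitrary line through x when p ≡ x
  lineThrough : Pt → Pt → Bl
  lineThrough p x with find (λ B → inc A p B ∧ inc A x B)
  ... | inj₁ (B , _) = B
  ... | inj₂ _ = proj₁ (1≤count⇒∃ {f = inc A x} (≤-trans (s≤s z≤n) (≤-reflexive (sym (replication A x)))))

  lineThrough-on : ∀ p x → p ≢ x → p on lineThrough p x × x on lineThrough p x
  lineThrough-on p x p≢x with find (λ B → inc A p B ∧ inc A x B)
  ... | inj₁ (B , pxB) = ∧-true pxB
  ... | inj₂ none with ∃-line-through p x p≢x
  ...   | B , pB , xB with () ← trans (sym (none B)) (∧-intro pB xB)

  -- joining p to the k points of M accounts for k of the k + 1 lines through p
  playfair : ∀ {p M B C} → inc A p M ≡ false → p on B → p on C →
    meets B M ≡ false → meets C M ≡ false → B ≡ C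
  playfair {p} {M} {B} {C} p∉M pB pC B∥M C∥M =
    count≤1⇒unique missesM (+-cancelˡ-≤ k _ _ count-bound) B C
      (∧-intro pB (cong not B∥M)) (∧-intro pC (cong not C∥M))
    where
    missesM hitsM : Bl → Bool
    missesM B = inc A p B ∧ not (meets B M)
    hitsM B = inc A p B ∧ meets B M
    p≢ : ∀ z → z on M → p ≢ z
    p≢ z zM refl with () ← trans (sym p∉M) zM
    join-injective : ∀ x y → x on M → y on M → lineThrough p x ≡ lineThrough p y → x ≡ y
    join-injective x y xM yM e =
      meet-unique (proj₂ (lineThrough-on p x (p≢ x xM)))
        (subst (y on_) (sym e) (proj₂ (lineThrough-on p y (p≢ y yM)))) xM yM
        (λ j≡M → p≢ p (subst (p on_) j≡M (proj₁ (lineThrough-on p x (p≢ x xM)))) refl)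
    k≤hits : k ≤ count hitsM
    k≤hits = ≤-trans (≤-reflexive (sym (blockSize A M)))
      (count-≤-injection (λ x → inc A x M) hitsM (lineThrough p)
        (λ x xM → let (pJ , xJ) = lineThrough-on p x (p≢ x xM) in ∧-intro pJ (meets-intro xJ xM))
        join-injective)
    count-bound : k + count missesM ≤ k + 1
    count-bound = begin
      k + count missesM              ≤⟨ +-monoˡ-≤ _ k≤hits ⟩
      count hitsM + count missesM    ≡⟨ sym (count-split (inc A p) (λ B → meets B M)) ⟩
      count (inc A p)                ≡⟨ replication A p ⟩
      suc k                          ≡⟨ +-comm 1 k ⟩
      k + 1                          ∎
      where open ≤-Reasoning

module Distances {k : ℕ} (A : AffinePlane k) (2≤k : 2 ≤ k) where
  open Counting
  open Geometry A

  1≤k : 1 ≤ k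
  1≤k = ≤-trans (s≤s z≤n) 2≤k

  N : ℕ
  N = k * k + (k * k + k)

  V : Set
  V = Fin N

  G : Graph N
  G = IncidenceGraph A

  Move : V → V → Set
  Move u w = (w ≡ u) ⊎ (adj G u w ≡ true)

  some-point : Pt
  some-point = fromℕ< {0} (*-mono-≤ 1≤k 1≤k)

  some-line : Bl
  some-line = fromℕ< {0} (≤-trans 1≤k (m≤n+m k (k * k)))

  decode : V → Pt ⊎ Bl
  decode = splitAt (k * k)

  encode : Pt ⊎ Bl → V
  encode = join (k * k) (k * k + k)

  decode-encode : ∀ s → decode (encode s) ≡ s
  decode-encode = splitAt-join (k * k) (k * k + k)

  decode-injective : ∀ {u v} → decode u ≡ decode v → u ≡ v
  decode-injective {u} {v} e = trans (sym (join-splitAt (k * k) (k * k + k) u))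
                                 (trans (cong encode e) (join-splitAt (k * k) (k * k + k) v))

  pt : Pt → V
  pt x = x ↑ˡ (k * k + k)

  ln : Bl → V
  ln B = (k * k) ↑ʳ B

  decode-pt : ∀ x → decode (pt x) ≡ inj₁ x
  decode-pt x = splitAt-↑ˡ (k * k) x (k * k + k)

  decode-ln : ∀ B → decode (ln B) ≡ inj₂ B
  decode-ln B = splitAt-↑ʳ (k * k) (k * k + k) B

  pt-injective : ∀ {x y} → pt x ≡ pt y → x ≡ y
  pt-injective {x} {y} e with trans (sym (decode-pt x)) (trans (cong decode e) (decode-pt y))
  ... | refl = refl

  ln-injective : ∀ {B C} → ln B ≡ ln C → B ≡ C
  ln-injective {B} {C} e with trans (sym (decode-ln B)) (trans (cong decode e) (decode-ln C))
  ... | refl = refl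

  pt≢ln : ∀ {x B} → pt x ≢ ln B
  pt≢ln {x} {B} e with trans (sym (decode-pt x)) (trans (cong decode e) (decode-ln B))
  ... | ()

  point-or-line : ∀ w → (Σ Pt λ x → w ≡ pt x) ⊎ (Σ Bl λ B → w ≡ ln B)
  point-or-line w with decode w in e
  ... | inj₁ x = inj₁ (x , sym (splitAt⁻¹-↑ˡ e))
  ... | inj₂ B = inj₂ (B , sym (splitAt⁻¹-↑ʳ e))

  incident : Pt ⊎ Bl → Pt ⊎ Bl → Bool
  incident (inj₁ x) (inj₂ B) = inc A x B
  incident (inj₂ B) (inj₁ x) = inc A x B
  incident (inj₁ _) (inj₁ _) = false
  incident (inj₂ _) (inj₂ _) = false

  adj-decode : ∀ u v → adj G u v ≡ incident (decode u) (decode v)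
  adj-decode u v with decode u | decode v
  ... | inj₁ x | inj₂ B = refl
  ... | inj₂ B | inj₁ x = refl
  ... | inj₁ _ | inj₁ _ = refl
  ... | inj₂ _ | inj₂ _ = refl

  adj-pt-ln : ∀ x B → adj G (pt x) (ln B) ≡ inc A x B
  adj-pt-ln x B rewrite adj-decode (pt x) (ln B) | decode-pt x | decode-ln B = refl

  adj-ln-pt : ∀ x B → adj G (ln B) (pt x) ≡ inc A x B
  adj-ln-pt x B rewrite adj-decode (ln B) (pt x) | decode-pt x | decode-ln B = refl

  adj-ln-ln : ∀ B C → adj G (ln B) (ln C) ≡ false
  adj-ln-ln B C rewrite adj-decode (ln B) (ln C) | decode-ln B | decode-ln C = refl

  adj-pt-pt : ∀ x y → adj G (pt x) (pt y) ≡ false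
  adj-pt-pt x y rewrite adj-decode (pt x) (pt y) | decode-pt x | decode-pt y = refl

  -- Distances in the incidence graph: two points are joined by a line, a point
  -- off a line reaches it through any point of the line, and two parallel lines
  -- are linked by a point of one and the line through it meeting the other.
  δ : Pt ⊎ Bl → Pt ⊎ Bl → ℕ
  δ (inj₁ x) (inj₁ y) = if ⌊ x ≟ᶠ y ⌋ then 0 else 2
  δ (inj₁ x) (inj₂ B) = if inc A x B then 1 else 3
  δ (inj₂ B) (inj₁ x) = if inc A x B then 1 else 3
  δ (inj₂ B) (inj₂ C) = if ⌊ B ≟ᶠ C ⌋ then 0 else (if meets B C then 2 else 4)

  δᵥ : V → V → ℕ
  δᵥ u v = δ (decode u) (decode v)

  δ-refl : ∀ s → δ s s ≡ 0
  δ-refl (inj₁ x) rewrite ⌊≟⌋-refl x = refl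
  δ-refl (inj₂ B) rewrite ⌊≟⌋-refl B = refl

  δ≡0⇒≡ : ∀ s t → δ s t ≡ 0 → s ≡ t
  δ≡0⇒≡ (inj₁ x) (inj₁ y) e with x ≟ᶠ y
  ... | yes refl = refl
  δ≡0⇒≡ (inj₁ x) (inj₂ B) e with inc A x B
  δ≡0⇒≡ (inj₁ x) (inj₂ B) () | true
  δ≡0⇒≡ (inj₁ x) (inj₂ B) () | false
  δ≡0⇒≡ (inj₂ B) (inj₁ x) e with inc A x B
  δ≡0⇒≡ (inj₂ B) (inj₁ x) () | true
  δ≡0⇒≡ (inj₂ B) (inj₁ x) () | false
  δ≡0⇒≡ (inj₂ B) (inj₂ C) e with B ≟ᶠ C
  ... | yes refl = refl
  ... | no _ with meets B C
  δ≡0⇒≡ (inj₂ B) (inj₂ C) () | no _ | true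
  δ≡0⇒≡ (inj₂ B) (inj₂ C) () | no _ | false

  δ-line-line-sym : ∀ B C → δ (inj₂ B) (inj₂ C) ≡ δ (inj₂ C) (inj₂ B)
  δ-line-line-sym B C with B ≟ᶠ C | C ≟ᶠ B
  ... | yes refl | yes _ = refl
  ... | yes refl | no C≢C = ⊥-elim (C≢C refl)
  ... | no B≢B | yes refl = ⊥-elim (B≢B refl)
  ... | no _ | no _ rewrite meets-sym B C = refl

  δ≡1⇒on : ∀ {x B} → (if inc A x B then 1 else 3) ≡ 1 → x on B
  δ≡1⇒on {x} {B} e with inc A x B
  ... | true = refl
  δ≡1⇒on {x} {B} () | false

  on⇒δ≡1 : ∀ {x B} → x on B → (if inc A x B then 1 else 3) ≡ 1
  on⇒δ≡1 xB rewrite xB = refl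

  δ-parity : ∀ s x B → δ s (inj₁ x) ≢ δ s (inj₂ B)
  δ-parity (inj₁ z) x B e with z ≟ᶠ x | inc A z B
  δ-parity (inj₁ z) x B () | yes _ | true
  δ-parity (inj₁ z) x B () | yes _ | false
  δ-parity (inj₁ z) x B () | no _ | true
  δ-parity (inj₁ z) x B () | no _ | false
  δ-parity (inj₂ C) x B e with inc A x C | C ≟ᶠ B
  δ-parity (inj₂ C) x B () | true | yes _
  δ-parity (inj₂ C) x B () | false | yes _
  δ-parity (inj₂ C) x B e | true | no _ with meets C B
  δ-parity (inj₂ C) x B () | true | no _ | true
  δ-parity (inj₂ C) x B () | true | no _ | false
  δ-parity (inj₂ C) x B e | false | no _ with meets C B
  δ-parity (inj₂ C) x B () | false | no _ | true
  δ-parity (inj₂ C) x B () | false | no _ | false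

  if≤ : ∀ (b : Bool) {x y z} → x ≤ z → y ≤ z → (if b then x else y) ≤ z
  if≤ true x≤z _ = x≤z
  if≤ false _ y≤z = y≤z

  δ≤4 : ∀ s t → δ s t ≤ 4
  δ≤4 (inj₁ x) (inj₁ y) = if≤ ⌊ x ≟ᶠ y ⌋ z≤n (s≤s (s≤s z≤n))
  δ≤4 (inj₁ x) (inj₂ B) = if≤ (inc A x B) (s≤s z≤n) (s≤s (s≤s (s≤s z≤n)))
  δ≤4 (inj₂ B) (inj₁ x) = if≤ (inc A x B) (s≤s z≤n) (s≤s (s≤s (s≤s z≤n)))
  δ≤4 (inj₂ B) (inj₂ C) = if≤ ⌊ B ≟ᶠ C ⌋ z≤n (if≤ (meets B C) (s≤s (s≤s z≤n)) ≤-refl)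

  δ-step : ∀ s s' t → incident s' t ≡ true → δ s t ≤ suc (δ s s')
  δ-step (inj₁ x) (inj₁ y) (inj₂ B) yB with x ≟ᶠ y
  ... | yes refl rewrite yB = ≤-refl
  ... | no _ = if≤ (inc A x B) (s≤s z≤n) ≤-refl
  δ-step (inj₁ x) (inj₂ B) (inj₁ y) yB with inc A x B
  ... | true = if≤ ⌊ x ≟ᶠ y ⌋ z≤n ≤-refl
  ... | false = if≤ ⌊ x ≟ᶠ y ⌋ z≤n (s≤s (s≤s z≤n))
  δ-step (inj₂ C) (inj₁ y) (inj₂ B) yB with inc A y C in yC
  ... | false = δ≤4 (inj₂ C) (inj₂ B)
  ... | true with C ≟ᶠ B
  ...   | yes _ = z≤n
  ...   | no _ rewrite meets-intro yC yB = ≤-refl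
  δ-step (inj₂ C) (inj₂ B) (inj₁ y) yB with C ≟ᶠ B
  ... | yes refl rewrite yB = ≤-refl
  ... | no _ = ≤-trans (if≤ (inc A y C) (s≤s z≤n) ≤-refl) (3≤1+ (meets C B))
    where
    3≤1+ : ∀ b → 3 ≤ suc (if b then 2 else 4)
    3≤1+ true = ≤-refl
    3≤1+ false = s≤s (s≤s (s≤s z≤n))
  δ-step (inj₁ _) (inj₁ _) (inj₁ _) ()
  δ-step (inj₁ _) (inj₂ _) (inj₂ _) ()
  δ-step (inj₂ _) (inj₁ _) (inj₁ _) ()
  δ-step (inj₂ _) (inj₂ _) (inj₂ _) ()

  δ-predecessor : ∀ s t d → δ s t ≡ suc d → ∃ λ s' → (incident s' t ≡ true) × (δ s s' ≡ d)
  δ-predecessor (inj₁ x) (inj₁ y) d e with x ≟ᶠ y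
  δ-predecessor (inj₁ x) (inj₁ y) d () | yes _
  δ-predecessor (inj₁ x) (inj₁ y) .1 refl | no x≢y with ∃-line-through x y x≢y
  ... | B , xB , yB = inj₂ B , yB , cong (λ b → if b then 1 else 3) xB
  δ-predecessor (inj₁ x) (inj₂ B) d e with inc A x B in xB
  δ-predecessor (inj₁ x) (inj₂ B) .0 refl | true = inj₁ x , xB , δ-refl (inj₁ x)
  δ-predecessor (inj₁ x) (inj₂ B) .2 refl | false with point-on 1≤k B
  ... | y , yB = inj₁ y , yB , cong (λ b → if b then 0 else 2) (⌊≟⌋-false (off≢on xB yB))
  δ-predecessor (inj₂ C) (inj₁ y) d e with inc A y C in yC
  δ-predecessor (inj₂ C) (inj₁ y) .0 refl | true = inj₂ C , yC , δ-refl (inj₂ C)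
  δ-predecessor (inj₂ C) (inj₁ y) .2 refl | false with point-on 1≤k C
  ... | z , zC with ∃-line-through y z (off≢on yC zC)
  ...   | B , yB , zB = inj₂ B , yB , δCB≡2
    where
    δCB≡2 : δ (inj₂ C) (inj₂ B) ≡ 2
    δCB≡2 rewrite ⌊≟⌋-false {a = C} {B} (λ { refl → off≢on yC yB refl }) | meets-intro zC zB = refl
  δ-predecessor (inj₂ C) (inj₂ B) d e with C ≟ᶠ B
  δ-predecessor (inj₂ C) (inj₂ B) d () | yes _
  δ-predecessor (inj₂ C) (inj₂ B) d e | no _ with meets C B in m
  δ-predecessor (inj₂ C) (inj₂ B) .1 refl | no _ | true with meets-elim m
  ... | z , zC , zB = inj₁ z , zB , cong (λ b → if b then 1 else 3) zC
  δ-predecessor (inj₂ C) (inj₂ B) .3 refl | no _ | false with point-on 1≤k B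
  ... | y , yB with inc A y C in yC
  ...   | true = ⊥-elim (¬meets m y yC yB)
  ...   | false = inj₁ y , yB , cong (λ b → if b then 1 else 3) yC

  reach⇒δ≤ : ∀ d u v → reach G d u v ≡ true → δᵥ u v ≤ d
  reach⇒δ≤ zero u v r with u ≟ᶠ v
  ... | yes refl = ≤-reflexive (δ-refl (decode u))
  reach⇒δ≤ (suc d) u v r with reach G d u v in r'
  ... | true = m≤n⇒m≤1+n (reach⇒δ≤ d u v r')
  ... | false with anyFin⇒∃ _ r
  ...   | w , rw with ∧-true {reach G d u w} rw
  ...     | uw , wv = ≤-trans (δ-step (decode u) (decode w) (decode v) (trans (sym (adj-decode w v)) wv))
                        (s≤s (reach⇒δ≤ d u w uw))

  δ≤⇒reach : ∀ d u v → δᵥ u v ≤ d → reach G d u v ≡ true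
  δ≤⇒reach zero u v δ≤0 with decode-injective (δ≡0⇒≡ (decode u) (decode v) (n≤0⇒n≡0 δ≤0))
  ... | refl = ⌊≟⌋-refl u
  δ≤⇒reach (suc d) u v δ≤ with δᵥ u v ≤? d
  ... | yes δ≤d rewrite δ≤⇒reach d u v δ≤d = refl
  ... | no δ≰d with δ-predecessor (decode u) (decode v) d (≤-antisym δ≤ (≰⇒> δ≰d))
  ...   | s' , s'v , δus' = trans (cong (reach G d u v ∨_) (anyFin-intro _ (encode s') via-s')) (Bool.∨-zeroʳ _)
    where
    via-s' : reach G d u (encode s') ∧ adj G (encode s') v ≡ true
    via-s' = ∧-intro (δ≤⇒reach d u (encode s') (≤-reflexive (trans (cong (δ (decode u)) (decode-encode s')) δus')))
                     (trans (adj-decode (encode s') v) (trans (cong (λ z → incident z (decode v)) (decode-encode s')) s'v))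

  searchDist-correct : ∀ u v i fuel → i ≤ δᵥ u v → δᵥ u v ≤ i + fuel → searchDist G u v i fuel ≡ δᵥ u v
  searchDist-correct u v i zero i≤ ≤i = ≤-antisym i≤ (≤-trans ≤i (≤-reflexive (+-identityʳ i)))
  searchDist-correct u v i (suc fuel) i≤ ≤i with reach G i u v in r
  ... | true = ≤-antisym i≤ (reach⇒δ≤ i u v r)
  ... | false = searchDist-correct u v (suc i) fuel i<δ (≤-trans ≤i (≤-reflexive (+-suc i fuel)))
    where
    i<δ : suc i ≤ δᵥ u v
    i<δ with δᵥ u v ≤? i
    ... | yes δ≤i with () ← trans (sym r) (δ≤⇒reach i u v δ≤i)
    ... | no δ≰i = ≰⇒> δ≰i

  4≤N : 4 ≤ N
  4≤N = ≤-trans (*-mono-≤ 2≤k 2≤k) (m≤m+n (k * k) (k * k + k))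

  dist≡δ : ∀ u v → dist G u v ≡ δᵥ u v
  dist≡δ u v = searchDist-correct u v 0 N z≤n (≤-trans (δ≤4 (decode u) (decode v)) 4≤N)

  δᵖ : V → Pt → ℕ
  δᵖ c x = δ (decode c) (inj₁ x)

  δˡ : V → Bl → ℕ
  δˡ c B = δ (decode c) (inj₂ B)

  dist-pt : ∀ c x → dist G c (pt x) ≡ δᵖ c x
  dist-pt c x = trans (dist≡δ c (pt x)) (cong (δ (decode c)) (decode-pt x))

  dist-ln : ∀ c B → dist G c (ln B) ≡ δˡ c B
  dist-ln c B = trans (dist≡δ c (ln B)) (cong (δ (decode c)) (decode-ln B))

module Readings {k : ℕ} (A : AffinePlane k) (2≤k : 2 ≤ k) where
  open Counting
  open UnionBound
  open Selection
  open Geometry A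
  open Distances A 2≤k

  readings : ∀ {m} → Vec V m → V → Vec ℕ m
  readings C u = map (λ c → dist G c u) C

  readings⇒δ≡ : ∀ {m} {C : Vec V m} {c u w} → c ∈ᵥ C → readings C u ≡ readings C w → δᵥ c u ≡ δᵥ c w
  readings⇒δ≡ {C = C} {c} {u} {w} c∈C same =
    trans (sym (dist≡δ c u)) (trans (map-≡-∈ (λ c → dist G c u) (λ c → dist G c w) C c∈C same) (dist≡δ c w))

  readings-pt-ln : ∀ {m} {C : Vec V m} {z B B'} → pt z ∈ᵥ C → readings C (ln B) ≡ readings C (ln B') →
    δ (inj₁ z) (inj₂ B) ≡ δ (inj₁ z) (inj₂ B')
  readings-pt-ln {z = z} {B} {B'} z∈C same
    with readings⇒δ≡ z∈C same
  ... | e rewrite decode-pt z | decode-ln B | decode-ln B' = e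

  readings-ln-pt : ∀ {m} {C : Vec V m} {M x y} → ln M ∈ᵥ C → readings C (pt x) ≡ readings C (pt y) →
    δ (inj₂ M) (inj₁ x) ≡ δ (inj₂ M) (inj₁ y)
  readings-ln-pt {M = M} {x} {y} M∈C same
    with readings⇒δ≡ M∈C same
  ... | e rewrite decode-ln M | decode-pt x | decode-pt y = e

  readings-ln-ln : ∀ {m} {C : Vec V m} {M B B'} → ln M ∈ᵥ C → readings C (ln B) ≡ readings C (ln B') →
    δ (inj₂ M) (inj₂ B) ≡ δ (inj₂ M) (inj₂ B')
  readings-ln-ln {M = M} {B} {B'} M∈C same
    with readings⇒δ≡ M∈C same
  ... | e rewrite decode-ln M | decode-ln B | decode-ln B' = e

  readings-parity : ∀ {m} → 1 ≤ m → (C : Vec V m) → ∀ x B → readings C (pt x) ≢ readings C (ln B)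
  readings-parity (s≤s _) (c ∷ C) x B same =
    δ-parity (decode c) x B (subst₂ (λ s t → δ (decode c) s ≡ δ (decode c) t) (decode-pt x) (decode-ln B)
      (readings⇒δ≡ {C = c ∷ C} (VecAny.here refl) same))

  readings-survivor : ∀ {m n} (at : Fin n → V) (bad : V → Fin n → Bool) (ref : V → ℕ) →
    (∀ c x → bad c x ≡ false → dist G c (at x) ≡ ref c) →
    (C : Vec V m) (x : Fin n) → survives bad C x ≡ true → readings C (at x) ≡ map ref C
  readings-survivor at bad ref ok C x s =
    map-cong-All _ ref C (All-map (λ {c} → ok c x) (survives⇒All bad C x s))

  _≠ᵇ_ : ℕ → ℕ → Bool
  a ≠ᵇ b = not ⌊ a ℕ.≟ b ⌋

  ≠ᵇ⇒≢ : ∀ {a b} → a ≠ᵇ b ≡ true → a ≢ b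
  ≠ᵇ⇒≢ {a} {b} e with a ℕ.≟ b
  ... | no a≢b = a≢b

  ¬≠ᵇ⇒≡ : ∀ {a b} → a ≠ᵇ b ≡ false → a ≡ b
  ¬≠ᵇ⇒≡ {a} {b} e with a ℕ.≟ b
  ... | yes a≡b = a≡b

  ≢⇒≠ᵇ : ∀ {a b} → a ≢ b → a ≠ᵇ b ≡ true
  ≢⇒≠ᵇ {a} {b} a≢b with a ℕ.≟ b
  ... | yes a≡b = ⊥-elim (a≢b a≡b)
  ... | no _ = refl

module Twins {k : ℕ} (A : AffinePlane k) (2≤k : 2 ≤ k) where
  open Counting
  open UnionBound
  open Geometry A
  open Distances A 2≤k
  open Readings A 2≤k

  -- reading of a probe at any line through p, apart from at most one exceptional line
  lineRef : Pt → Pt ⊎ Bl → ℕ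
  lineRef p (inj₁ z) = if ⌊ z ≟ᶠ p ⌋ then 1 else 3
  lineRef p (inj₂ M) = 2

  singlesOut-line : Pt → V → Bl → Bool
  singlesOut-line p c B = δˡ c B ≠ᵇ lineRef p (decode c)

  lineRef-exception-unique : ∀ p s B₁ B₂ → p on B₁ → p on B₂ →
    δ s (inj₂ B₁) ≢ lineRef p s → δ s (inj₂ B₂) ≢ lineRef p s → B₁ ≡ B₂
  lineRef-exception-unique p (inj₁ z) B₁ B₂ pB₁ pB₂ x₁ x₂ with z ≟ᶠ p
  ... | yes refl rewrite pB₁ = ⊥-elim (x₁ refl)
  ... | no z≢p with inc A z B₁ in zB₁ | inc A z B₂ in zB₂
  ...   | true | true = line-unique z≢p zB₁ pB₁ zB₂ pB₂
  ...   | false | _ = ⊥-elim (x₁ refl)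
  ...   | true | false = ⊥-elim (x₂ refl)
  lineRef-exception-unique p (inj₂ M) B₁ B₂ pB₁ pB₂ x₁ x₂ with inc A p M in pM
  ... | true = trans (≡M B₁ pB₁ x₁) (sym (≡M B₂ pB₂ x₂))
    where
    ≡M : ∀ B → p on B → δ (inj₂ M) (inj₂ B) ≢ 2 → B ≡ M
    ≡M B pB x with M ≟ᶠ B
    ... | yes M≡B = sym M≡B
    ... | no _ rewrite meets-intro pM pB = ⊥-elim (x refl)
  ... | false = playfair pM pB₁ pB₂ (misses B₁ pB₁ x₁) (misses B₂ pB₂ x₂)
    where
    misses : ∀ B → p on B → δ (inj₂ M) (inj₂ B) ≢ 2 → meets B M ≡ false
    misses B pB x with M ≟ᶠ B
    ... | yes refl with () ← trans (sym pM) pB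
    ... | no _ with meets M B in MB
    ...   | true = ⊥-elim (x refl)
    ...   | false = trans (meets-sym B M) MB

  readings-line-survivor : ∀ {m} p (C : Vec V m) B → survives (singlesOut-line p) C B ≡ true →
    readings C (ln B) ≡ map (λ c → lineRef p (decode c)) C
  readings-line-survivor p = readings-survivor ln (singlesOut-line p) (λ c → lineRef p (decode c))
    (λ c B s → trans (dist-ln c B) (¬≠ᵇ⇒≡ s))

  record TwinLines (p : Pt) {m} (C : Vec V m) : Set where
    field
      L L'  : Bl
      L≢L'  : L ≢ L'
      p∈L   : p on L
      p∈L'  : p on L'
      same  : readings C (ln L) ≡ readings C (ln L')

  -- each probe singles out at most one of the k + 1 lines through p
  twin-lines : ∀ {m} → m < k → (p : Pt) (C : Vec V m) → TwinLines p C
  twin-lines {m} m<k p C = twins (2≤count⇒distinct survivor 2≤survivors)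
    where
    survivor : Bl → Bool
    survivor B = inc A p B ∧ survives (singlesOut-line p) C B
    at-most-one : ∀ c → count (λ B → inc A p B ∧ singlesOut-line p c B) ≤ 1
    at-most-one c = count≤1 _ λ B₁ B₂ s₁ s₂ →
      let (pB₁ , x₁) = ∧-true {inc A p B₁} s₁ ; (pB₂ , x₂) = ∧-true {inc A p B₂} s₂ in
      lineRef-exception-unique p (decode c) B₁ B₂ pB₁ pB₂ (≠ᵇ⇒≢ x₁) (≠ᵇ⇒≢ x₂)
    2≤survivors : 2 ≤ count survivor
    2≤survivors = +-cancelʳ-≤ m 2 _ (begin
      2 + m                                       ≤⟨ s≤s m<k ⟩
      suc k                                       ≡⟨ sym (replication A p) ⟩
      count (inc A p)                             ≤⟨ union-bound (inc A p) (singlesOut-line p) (λ _ → 1) C at-most-one ⟩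
      count survivor + vsum (λ _ → 1) C           ≤⟨ +-monoʳ-≤ (count survivor) (vsum≤length _ C (λ _ → ≤-refl)) ⟩
      count survivor + m                          ∎)
      where open ≤-Reasoning
    twins : (Σ Bl λ L → Σ Bl λ L' → L ≢ L' × survivor L ≡ true × survivor L' ≡ true) → TwinLines p C
    twins (L , L' , L≢L' , sL , sL') with ∧-true {inc A p L} sL | ∧-true {inc A p L'} sL'
    ... | pL , survL | pL' , survL' = record
      { L = L ; L' = L' ; L≢L' = L≢L' ; p∈L = pL ; p∈L' = pL'
      ; same = trans (readings-line-survivor p C L survL) (sym (readings-line-survivor p C L' survL')) }

  module TwinPoints (v : Pt) (L L' : Bl) (L≢L' : L ≢ L') (vL : v on L) (vL' : v on L') where

    -- reading of a probe at any point of X, apart from at most one exceptional point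
    pointRefˢ : Bl → Pt ⊎ Bl → ℕ
    pointRefˢ X (inj₁ z) = 2
    pointRefˢ X (inj₂ M) = if ⌊ M ≟ᶠ X ⌋ then 1 else 3

    pointRef : Bl → V → ℕ
    pointRef X c = pointRefˢ X (decode c)

    singlesOut : Bl → V → Pt → Bool
    singlesOut X c x = δᵖ c x ≠ᵇ pointRef X c

    singlesOut-unique : ∀ X c x y → x on X → y on X → singlesOut X c x ≡ true → singlesOut X c y ≡ true → x ≡ y
    singlesOut-unique X c x y xX yX sx sy = unique (decode c) (≠ᵇ⇒≢ sx) (≠ᵇ⇒≢ sy)
      where
      unique : ∀ s → δ s (inj₁ x) ≢ pointRefˢ X s → δ s (inj₁ y) ≢ pointRefˢ X s → x ≡ y
      unique (inj₁ z) ex ey with z ≟ᶠ x | z ≟ᶠ y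
      ... | yes refl | yes refl = refl
      ... | no _ | _ = ⊥-elim (ex refl)
      ... | yes _ | no _ = ⊥-elim (ey refl)
      unique (inj₂ M) ex ey with M ≟ᶠ X
      ... | yes refl rewrite xX = ⊥-elim (ex refl)
      ... | no M≢X with inc A x M in xM | inc A y M in yM
      ...   | true | true = meet-unique xM yM xX yX M≢X
      ...   | false | _ = ⊥-elim (ex refl)
      ...   | true | false = ⊥-elim (ey refl)

    readings-point-survivor : ∀ {m} X (C : Vec V m) x → survives (singlesOut X) C x ≡ true →
      readings C (pt x) ≡ map (pointRef X) C
    readings-point-survivor X = readings-survivor pt (singlesOut X) (pointRef X)
      (λ c x s → trans (dist-pt c x) (¬≠ᵇ⇒≡ s))

    onLine onLine∖v : Bl → Pt → Bool
    onLine X x = inc A x X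
    onLine∖v X = remove v (onLine X)

    onLine∖v⇒on : ∀ {X x} → onLine∖v X x ≡ true → x on X
    onLine∖v⇒on {X} {x} p = proj₁ (∧-true {inc A x X} p)

    onLine∖v⇒≢v : ∀ {X x} → onLine∖v X x ≡ true → x ≢ v
    onLine∖v⇒≢v {X} {x} p = ≢ᵇ⇒≢ (proj₂ (∧-true {inc A x X} p))

    marksL marksL∖v : Bl → V → ℕ
    marksL X = marks (onLine X) (singlesOut X)
    marksL∖v X = marks (onLine∖v X) (singlesOut X)

    touchesˢ : Pt ⊎ Bl → Bool
    touchesˢ (inj₁ z) = ⌊ z ≟ᶠ v ⌋
    touchesˢ (inj₂ M) = inc A v M

    touches : V → Bool
    touches c = touchesˢ (decode c)

    isLn : Bl → V → ℕ
    isLn X c = indicator ⌊ c ≟ᶠ ln X ⌋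

    marksL-ln : ∀ X → marksL X (ln X) ≡ 0
    marksL-ln X = marks≡0 (onLine X) (singlesOut X) (ln X) quiet
      where
      quiet : ∀ x → x on X → singlesOut X (ln X) x ≡ false
      quiet x xX rewrite decode-ln X | xX | ⌊≟⌋-refl X = refl

    marksL∖v-touching : ∀ X c → v on X → touches c ≡ true → marksL∖v X c ≡ 0
    marksL∖v-touching X c vX t = marks≡0 (onLine∖v X) (singlesOut X) c (λ x d → quiet x d (decode c) t)
      where
      quiet : ∀ x → onLine∖v X x ≡ true → ∀ s → touchesˢ s ≡ true → δ s (inj₁ x) ≠ᵇ pointRefˢ X s ≡ false
      quiet x d (inj₁ z) t with z ≟ᶠ x
      ... | yes refl = ⊥-elim (onLine∖v⇒≢v d (⌊≟⌋-true t))
      ... | no _ = refl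
      quiet x d (inj₂ M) t with M ≟ᶠ X
      ... | yes refl rewrite onLine∖v⇒on {X} d = refl
      ... | no M≢X with inc A x M in xM
      ...   | true = ⊥-elim (onLine∖v⇒≢v d (meet-unique xM t (onLine∖v⇒on d) vX M≢X))
      ...   | false = refl

    v-reads-pointRef : ∀ X → v on X → ∀ c → touches c ≡ false → δᵖ c v ≡ pointRef X c
    v-reads-pointRef X vX c t = generic (decode c) t
      where
      generic : ∀ s → touchesˢ s ≡ false → δ s (inj₁ v) ≡ pointRefˢ X s
      generic (inj₁ z) t with z ≟ᶠ v
      generic (inj₁ z) () | yes _
      ... | no _ = refl
      generic (inj₂ M) t with M ≟ᶠ X
      ... | yes refl with () ← trans (sym t) vX
      ... | no _ rewrite t = refl

    readings-v : ∀ {m} X (C : Vec V m) → All (λ c → δᵖ c v ≡ pointRef X c) C → readings C (pt v) ≡ map (pointRef X) C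
    readings-v X C h = map-cong-All _ (pointRef X) C (All-map (λ {c} e → trans (dist-pt c v) e) h)

    isLn≡0⇒≢ : ∀ X c → isLn X c ≡ 0 → c ≢ ln X
    isLn≡0⇒≢ X c i refl rewrite ⌊≟⌋-refl (ln X) with () ← i

    pointRef-L≡L' : ∀ c → isLn L c ≡ 0 → isLn L' c ≡ 0 → pointRef L c ≡ pointRef L' c
    pointRef-L≡L' c notL notL' with decode c in e
    ... | inj₁ z = refl
    ... | inj₂ M with M ≟ᶠ L | M ≟ᶠ L'
    ...   | yes refl | _ = ⊥-elim (isLn≡0⇒≢ L c notL (decode-injective (trans e (sym (decode-ln M)))))
    ...   | no _ | yes refl = ⊥-elim (isLn≡0⇒≢ L' c notL' (decode-injective (trans e (sym (decode-ln M)))))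
    ...   | no _ | no _ = refl

    survivors-on : ∀ {m} X (C : Vec V m) j → j + vsum (marksL X) C ≤ k →
      j ≤ count (λ x → onLine X x ∧ survives (singlesOut X) C x)
    survivors-on X C j j+W≤k = many-survivors (onLine X) (singlesOut X) C j
      (λ c x y → singlesOut-unique X c x y) (≤-trans j+W≤k (≤-reflexive (sym (blockSize A X))))

    survivors-on∖v : ∀ {m} X (C : Vec V m) → v on X → ∀ j → suc j + vsum (marksL∖v X) C ≤ k →
      j ≤ count (λ x → onLine∖v X x ∧ survives (singlesOut X) C x)
    survivors-on∖v X C vX j j+W<k = many-survivors (onLine∖v X) (singlesOut X) C j
      (λ c x y dx dy → singlesOut-unique X c x y (onLine∖v⇒on dx) (onLine∖v⇒on dy))
      (≤-pred (≤-trans j+W<k (≤-reflexive (trans (sym (blockSize A X)) (count-remove-member (onLine X) vX)))))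

    record Survivor {m} (X : Bl) (C : Vec V m) : Set where
      field
        point  : Pt
        on∖v   : onLine∖v X point ≡ true
        reads  : readings C (pt point) ≡ map (pointRef X) C

    survivor∖v : ∀ {m} X (C : Vec V m) → v on X → 2 + vsum (marksL∖v X) C ≤ k → Survivor X C
    survivor∖v X C vX 2+W≤k with 1≤count⇒∃ (survivors-on∖v X C vX 1 2+W≤k)
    ... | q , sq = let (dq , survq) = ∧-true {onLine∖v X q} sq in
      record { point = q ; on∖v = dq ; reads = readings-point-survivor X C q survq }

    data Escape {m} (C : Vec V m) : Set where
      stay : readings C (ln L) ≡ readings C (ln L') → Escape C
      move : ∀ p q → p on L → q on L ⊎ q on L' → p ≢ q → readings C (pt p) ≡ readings C (pt q) → Escape C

    record TwoPoints {m} (X : Bl) (C : Vec V m) : Set where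
      field
        p q   : Pt
        p≢q   : p ≢ q
        p∈X   : p on X
        q∈X   : q on X
        same  : readings C (pt p) ≡ readings C (pt q)

    two-survivors : ∀ {m} X (C : Vec V m) (D : Pt → Bool) → (∀ {x} → D x ≡ true → x on X) →
      2 ≤ count (λ x → D x ∧ survives (singlesOut X) C x) → TwoPoints X C
    two-survivors X C D D⊆X 2≤ = two (2≤count⇒distinct _ 2≤)
      where
      two : (Σ Pt λ p → Σ Pt λ q → p ≢ q × D p ∧ survives (singlesOut X) C p ≡ true ×
                                           D q ∧ survives (singlesOut X) C q ≡ true) → TwoPoints X C
      two (p , q , p≢q , sp , sq) with ∧-true {D p} sp | ∧-true {D q} sq
      ... | dp , survp | dq , survq = record
        { p = p ; q = q ; p≢q = p≢q ; p∈X = D⊆X dp ; q∈X = D⊆X dq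
        ; same = trans (readings-point-survivor X C p survp) (sym (readings-point-survivor X C q survq)) }

    move-within-L : ∀ {m} {C : Vec V m} → TwoPoints L C → Escape C
    move-within-L two = move p q p∈X (inj₁ q∈X) p≢q same
      where open TwoPoints two

    private
      2+W≤k : ∀ {W J m} → W + J ≤ m → m < k → 1 ≤ J → 2 + W ≤ k
      2+W≤k {W} W+J≤m m<k 1≤J =
        ≤-trans (s≤s (≤-trans (≤-trans (≤-reflexive (+-comm 1 W)) (+-monoʳ-≤ W 1≤J)) W+J≤m)) m<k

      no-room⇒≡0 : ∀ {W J U m} → W + (J + U) ≤ m → m < k → ¬ (3 + W ≤ k) → 1 ≤ J → U ≡ 0
      no-room⇒≡0 {U = zero} _ _ _ _ = refl
      no-room⇒≡0 {W} {J} {suc U} {m} W+J+U≤m m<k 3+W≰k 1≤J =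
        ⊥-elim (3+W≰k (≤-trans (s≤s (≤-trans 2+W≤ W+J+U≤m)) m<k))
        where
        2+W≤ : 2 + W ≤ W + (J + suc U)
        2+W≤ = ≤-trans (≤-reflexive (+-comm 2 W)) (+-monoʳ-≤ W (+-mono-≤ 1≤J (s≤s (z≤n {U}))))

      all-probes-mark : ∀ {m W} → m < k → ¬ (2 + W ≤ k) → m ≤ W
      all-probes-mark m<k 2+W≰k = ≤-pred (≤-trans m<k (≤-pred (≰⇒> 2+W≰k)))

      indicator≡0 : ∀ b → indicator b ≡ 0 → b ≡ false
      indicator≡0 false _ = refl

    +isLn≤1 : ∀ (w : V → ℕ) X → (∀ c → w c ≤ 1) → w (ln X) ≡ 0 → ∀ c → w c + isLn X c ≤ 1
    +isLn≤1 w X w≤1 w0 c with c ≟ᶠ ln X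
    ... | yes refl rewrite w0 = ≤-refl
    ... | no _ = ≤-trans (≤-reflexive (+-identityʳ (w c))) (w≤1 c)

    touches-ln : ∀ X → v on X → touches (ln X) ≡ true
    touches-ln X vX rewrite decode-ln X = vX

    marksL∖v+touches≤1 : ∀ X → v on X → ∀ c → marksL∖v X c + indicator (touches c) ≤ 1
    marksL∖v+touches≤1 X vX c with touches c in t
    ... | true rewrite marksL∖v-touching X c vX t = ≤-refl
    ... | false = ≤-trans (≤-reflexive (+-identityʳ _)) (marks≤1 (onLine∖v X) (singlesOut X) c)

    -- probing L wastes a probe, so two points of L keep their reference readings
    escape-L-probed : ∀ {m} → m < k → (C : Vec V m) → 1 ≤ vsum (isLn L) C → Escape C
    escape-L-probed m<k C 1≤J =
      move-within-L (two-survivors L C (onLine L) (λ x → x) (survivors-on L C 2 (2+W≤k W+J≤m m<k 1≤J)))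
      where
      W+J≤m = vsum-pointwise≤1 (marksL L) (isLn L) C
                (+isLn≤1 (marksL L) L (marks≤1 (onLine L) (singlesOut L)) (marksL-ln L))

    -- either L ∖ v keeps two unsingled points, or almost every probe singles out a point
    -- of L ∖ v; then ln L' is the only probe touching v, so v reads like the points of L'
    escape-L'-probed : ∀ {m} → m < k → (C : Vec V m) → 1 ≤ vsum (isLn L') C → Escape C
    escape-L'-probed {m} m<k C 1≤J' = by-room (3 + vsum (marksL∖v L) C ≤? k)
      where
      by-room : Dec (3 + vsum (marksL∖v L) C ≤ k) → Escape C
      by-room (yes 3+W≤k) =
        move-within-L (two-survivors L C (onLine∖v L) onLine∖v⇒on (survivors-on∖v L C vL 2 3+W≤k))
      by-room (no 3+W≰k) =
        move v q vL (inj₂ (onLine∖v⇒on q∈)) (λ v≡q → onLine∖v⇒≢v q∈ (sym v≡q))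
          (trans (readings-v L' C (All-map (λ {c} → v-generic c) (vsum≡0 others C no-others))) (sym q-reads))
        where
        others : V → ℕ
        others c = indicator (touches c ∧ c ≢ᵇ ln L')
        pointwise : ∀ c → marksL∖v L c + (isLn L' c + others c) ≤ 1
        pointwise c with c ≟ᶠ ln L'
        ... | yes refl rewrite Bool.∧-zeroʳ (touches (ln L')) | marksL∖v-touching L (ln L') vL (touches-ln L' vL') = ≤-refl
        ... | no _ rewrite Bool.∧-identityʳ (touches c) = marksL∖v+touches≤1 L vL c
        no-others : vsum others C ≡ 0
        no-others = no-room⇒≡0 (subst (_≤ m) split (vsum≤length _ C pointwise)) m<k 3+W≰k 1≤J'
          where
          split = trans (vsum-+ (marksL∖v L) _ C) (cong (vsum (marksL∖v L) C +_) (vsum-+ (isLn L') others C))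
        v-generic : ∀ c → others c ≡ 0 → δᵖ c v ≡ pointRef L' c
        v-generic c o with c ≟ᶠ ln L'
        ... | yes refl = trans (cong (λ s → δ s (inj₁ v)) (decode-ln L'))
                           (trans (on⇒δ≡1 vL') (sym (trans (cong (pointRefˢ L') (decode-ln L'))
                                                           (cong (λ b → if b then 1 else 3) (⌊≟⌋-refl L')))))
        ... | no _ = v-reads-pointRef L' vL' c (indicator≡0 (touches c) (trans (cong indicator (sym (Bool.∧-identityʳ _))) o))
        W'+J'≤m = vsum-pointwise≤1 (marksL∖v L') (isLn L') C
                    (+isLn≤1 (marksL∖v L') L' (marks≤1 (onLine∖v L') (singlesOut L'))
                      (marksL∖v-touching L' (ln L') vL' (touches-ln L' vL')))
        open Survivor (survivor∖v L' C vL' (2+W≤k W'+J'≤m m<k 1≤J')) renaming (point to q; on∖v to q∈; reads to q-reads)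

    -- a probe touching v singles out no point of L ∖ v or L' ∖ v, so both keep a survivor
    escape-touching : ∀ {m} → m < k → (C : Vec V m) → vsum (isLn L) C ≡ 0 → vsum (isLn L') C ≡ 0 →
      1 ≤ vsum (λ c → indicator (touches c)) C → Escape C
    escape-touching m<k C notL notL' 1≤T =
      move p q (onLine∖v⇒on p∈) (inj₂ (onLine∖v⇒on q∈)) p≢q (trans p-reads (trans same-ref (sym q-reads)))
      where
      same-ref : map (pointRef L) C ≡ map (pointRef L') C
      same-ref = map-cong-All (pointRef L) (pointRef L') C
        (All-map (λ { {c} (nL , nL') → pointRef-L≡L' c nL nL' }) (All-zip (vsum≡0 (isLn L) C notL , vsum≡0 (isLn L') C notL')))
      survivor : ∀ X → v on X → Survivor X C
      survivor X vX = survivor∖v X C vX (2+W≤k (vsum-pointwise≤1 (marksL∖v X) _ C (marksL∖v+touches≤1 X vX)) m<k 1≤T)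
      open Survivor (survivor L vL) renaming (point to p; on∖v to p∈; reads to p-reads)
      open Survivor (survivor L' vL') renaming (point to q; on∖v to q∈; reads to q-reads)
      p≢q : p ≢ q
      p≢q p≡q = onLine∖v⇒≢v p∈
        (meet-unique (onLine∖v⇒on p∈) vL (subst (_on L') (sym p≡q) (onLine∖v⇒on q∈)) vL' L≢L')

    -- a probe not touching v that singles out a point of L ∖ v and one of L' ∖ v is a
    -- point equal to neither, or a line through both, and so reads L and L' alike
    lines-read-alike : ∀ c → touches c ≡ false → marksL∖v L c ≡ 1 → marksL∖v L' c ≡ 1 →
      dist G c (ln L) ≡ dist G c (ln L')
    lines-read-alike c t mL mL' =
      trans (dist-ln c L) (trans (alike a b (decode c) a∈ b∈ t sa sb) (sym (dist-ln c L')))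
      where
      a-marked = marks≡1⇒∃ (onLine∖v L) (singlesOut L) c mL
      b-marked = marks≡1⇒∃ (onLine∖v L') (singlesOut L') c mL'
      a = proj₁ a-marked
      a∈ = proj₁ (proj₂ a-marked)
      sa = proj₂ (proj₂ a-marked)
      b = proj₁ b-marked
      b∈ = proj₁ (proj₂ b-marked)
      sb = proj₂ (proj₂ b-marked)
      alike : ∀ a b s → onLine∖v L a ≡ true → onLine∖v L' b ≡ true → touchesˢ s ≡ false →
        δ s (inj₁ a) ≠ᵇ pointRefˢ L s ≡ true → δ s (inj₁ b) ≠ᵇ pointRefˢ L' s ≡ true →
        δ s (inj₂ L) ≡ δ s (inj₂ L')
      alike a b (inj₁ z) a∈ b∈ t sa sb with z ≟ᶠ a | z ≟ᶠ b
      ... | yes refl | yes refl =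
        ⊥-elim (onLine∖v⇒≢v a∈ (meet-unique (onLine∖v⇒on a∈) vL (onLine∖v⇒on b∈) vL' L≢L'))
      ... | no _ | _ with () ← sa
      ... | yes _ | no _ with () ← sb
      alike a b (inj₂ M) a∈ b∈ t sa sb with M ≟ᶠ L | M ≟ᶠ L'
      ... | yes refl | _ with () ← trans (sym t) vL
      ... | no _ | yes refl with () ← trans (sym t) vL'
      ... | no _ | no _ with inc A a M in aM | inc A b M in bM
      ...   | false | _ with () ← sa
      ...   | true | false with () ← sb
      ...   | true | true rewrite meets-intro aM (onLine∖v⇒on a∈) | meets-intro bM (onLine∖v⇒on b∈) = refl

    escape-untouched : ∀ {m} → m < k → (C : Vec V m) → All (λ c → touches c ≡ false) C → Escape C
    escape-untouched {m} m<k C untouched = by-room (2 + vsum (marksL∖v L) C ≤? k) (2 + vsum (marksL∖v L') C ≤? k)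
      where
      v-reads : ∀ X → v on X → readings C (pt v) ≡ map (pointRef X) C
      v-reads X vX = readings-v X C (All-map (λ {c} → v-reads-pointRef X vX c) untouched)
      all-mark : ∀ X → ¬ (2 + vsum (marksL∖v X) C ≤ k) → All (λ c → marksL∖v X c ≡ 1) C
      all-mark X 2+W≰k = vsum≡length (marksL∖v X) C (marks≤1 (onLine∖v X) (singlesOut X)) (all-probes-mark m<k 2+W≰k)
      by-room : Dec (2 + vsum (marksL∖v L) C ≤ k) → Dec (2 + vsum (marksL∖v L') C ≤ k) → Escape C
      by-room (yes 2+W≤k) _ =
        move p v (onLine∖v⇒on p∈) (inj₁ vL) (onLine∖v⇒≢v p∈) (trans p-reads (sym (v-reads L vL)))
        where open Survivor (survivor∖v L C vL 2+W≤k) renaming (point to p; on∖v to p∈; reads to p-reads)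
      by-room (no _) (yes 2+W'≤k) =
        move v q vL (inj₂ (onLine∖v⇒on q∈)) (λ v≡q → onLine∖v⇒≢v q∈ (sym v≡q)) (trans (v-reads L' vL') (sym q-reads))
        where open Survivor (survivor∖v L' C vL' 2+W'≤k) renaming (point to q; on∖v to q∈; reads to q-reads)
      by-room (no 2+W≰k) (no 2+W'≰k) = stay (map-cong-All (λ c → dist G c (ln L)) (λ c → dist G c (ln L')) C
        (All-map (λ { {c} (t , mL , mL') → lines-read-alike c t mL mL' })
          (All-zip (untouched , All-zip (all-mark L 2+W≰k , all-mark L' 2+W'≰k)))))

    escape : ∀ {m} → m < k → (C : Vec V m) → Escape C
    escape m<k C = by-probes (vsum (isLn L) C) (vsum (isLn L') C) (vsum (λ c → indicator (touches c)) C) refl refl refl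
      where
      by-probes : ∀ J J' T → vsum (isLn L) C ≡ J → vsum (isLn L') C ≡ J' →
        vsum (λ c → indicator (touches c)) C ≡ T → Escape C
      by-probes (suc _) _ _ eJ _ _ = escape-L-probed m<k C (≤-trans (s≤s z≤n) (≤-reflexive (sym eJ)))
      by-probes zero (suc _) _ _ eJ' _ = escape-L'-probed m<k C (≤-trans (s≤s z≤n) (≤-reflexive (sym eJ')))
      by-probes zero zero (suc _) eJ eJ' eT = escape-touching m<k C eJ eJ' (≤-trans (s≤s z≤n) (≤-reflexive (sym eT)))
      by-probes zero zero zero _ _ eT = escape-untouched m<k C (All-map (λ {c} → indicator≡0 (touches c)) (vsum≡0 _ C eT))

module LowerBound {k : ℕ} (A : AffinePlane k) (2≤k : 2 ≤ k) where
  open Geometry A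
  open Distances A 2≤k
  open Readings A 2≤k
  open Twins A 2≤k

  module Game (m : ℕ) (m<k : m < k) (σ : Strategy N m) where

    -- on-line a v L L' : the robber is on L, entered from v at round a (or started there),
    -- and L' is a line through v that has read like L ever since
    data RobberState : Set where
      on-line  : (a : ℕ) (v : Pt) (L L' : Bl) → L ≢ L' → v on L → v on L' → RobberState
      at-point : Pt → RobberState

    position : RobberState → V
    position (on-line _ _ L _ _ _ _) = ln L
    position (at-point p) = pt p

    from-point : ℕ → (p : Pt) {C : Vec V m} → TwinLines p C → RobberState
    from-point t p tw = on-line t p L L' L≢L' p∈L p∈L'
      where open TwinLines tw

    from-line : ∀ a v L L' L≢L' vL vL' {C : Vec V m} → TwinPoints.Escape v L L' L≢L' vL vL' C → RobberState
    from-line a v L L' L≢L' vL vL' (TwinPoints.stay _) = on-line a v L L' L≢L' vL vL'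
    from-line a v L L' L≢L' vL vL' (TwinPoints.move p _ _ _ _ _) = at-point p

    respond : ℕ → RobberState → Vec V m → RobberState
    respond t (at-point p) C = from-point t p (twin-lines m<k p C)
    respond t (on-line a v L L' L≢L' vL vL') C =
      from-line a v L L' L≢L' vL vL' (TwinPoints.escape v L L' L≢L' vL vL' m<k C)

    play : ℕ → RobberState × List (Vec ℕ m)
    play zero = let s = respond 0 (at-point some-point) (σ []) in s , (readings (σ []) (position s) ∷ [])
    play (suc t) = let (s , h) = play t ; s' = respond (suc t) s (σ h) in
                   s' , (readings (σ h) (position s') ∷ h)

    state : ℕ → RobberState
    state t = proj₁ (play t)

    heard : ℕ → List (Vec ℕ m)
    heard t = proj₂ (play t)

    robber : ℕ → V
    robber t = position (state t)

    history-robber : ∀ t → history G σ robber (suc t) ≡ heard t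
    history-robber zero = refl
    history-robber (suc t) rewrite history-robber t = refl

    respond-move : ∀ t s C → Move (position s) (position (respond t s C))
    respond-move t (at-point p) C = inj₂ (trans (adj-pt-ln p L) p∈L)
      where open TwinLines (twin-lines m<k p C)
    respond-move t (on-line a v L L' L≢L' vL vL') C with TwinPoints.escape v L L' L≢L' vL vL' m<k C
    ... | TwinPoints.stay _ = inj₁ refl
    ... | TwinPoints.move p _ pL _ _ _ = inj₂ (trans (adj-ln-pt p L) pL)

    robber-walk : RobberWalk G
    robber-walk = robber , λ t → respond-move (suc t) (state t) (σ (heard t))

    readingsAt : ℕ → V → Vec ℕ m
    readingsAt s u = readings (σ (history G σ robber s)) u

    readingsAt-suc : ∀ t u → readingsAt (suc t) u ≡ readings (σ (heard t)) u
    readingsAt-suc t u = cong (λ h → readings (σ h) u) (history-robber t)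

    history-agrees : ∀ (r : ℕ → V) t → (∀ s → s ≤ t → readingsAt s (r s) ≡ readingsAt s (robber s)) →
      history G σ r (suc t) ≡ history G σ robber (suc t)
    history-agrees r t agree = go (suc t) (λ s s<t → agree s (≤-pred s<t))
      where
      go : ∀ t → (∀ s → s < t → readingsAt s (r s) ≡ readingsAt s (robber s)) → history G σ r t ≡ history G σ robber t
      go zero _ = refl
      go (suc t) agree rewrite go t (λ s s<t → agree s (m≤n⇒m≤1+n s<t)) = cong (_∷ history G σ robber t) (agree t ≤-refl)

    -- the alternative walk: the robber's until round a, then L' until round b, then q
    shadow : ℕ → ℕ → Bl → Pt → ℕ → V
    shadow a b L' q s with s <? a
    ... | yes _ = robber s
    ... | no _ with s <? b
    ...   | yes _ = ln L'
    ...   | no _ = pt q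

    shadow-before : ∀ a b L' q s → s < a → shadow a b L' q s ≡ robber s
    shadow-before a b L' q s s<a with s <? a
    ... | yes _ = refl
    ... | no s≮a = ⊥-elim (s≮a s<a)

    shadow-during : ∀ a b L' q s → a ≤ s → s < b → shadow a b L' q s ≡ ln L'
    shadow-during a b L' q s a≤s s<b with s <? a
    ... | yes s<a = ⊥-elim (<⇒≱ s<a a≤s)
    ... | no _ with s <? b
    ...   | yes _ = refl
    ...   | no s≮b = ⊥-elim (s≮b s<b)

    shadow-after : ∀ a b L' q s → a ≤ s → b ≤ s → shadow a b L' q s ≡ pt q
    shadow-after a b L' q s a≤s b≤s with s <? a
    ... | yes s<a = ⊥-elim (<⇒≱ s<a a≤s)
    ... | no _ with s <? b
    ...   | yes s<b = ⊥-elim (<⇒≱ s<b b≤s)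
    ...   | no _ = refl

    shadow-moves : ∀ a b L' q → a ≤ b → (∀ a' → a ≡ suc a' → Move (robber a') (shadow a b L' q a)) →
      (a < b → q on L') → ∀ s → Move (shadow a b L' q s) (shadow a b L' q (suc s))
    shadow-moves a b L' q a≤b enter leave s = by-phase (suc s <? a) (s <? a) (suc s <? b) (s <? b)
      where
      F = shadow a b L' q
      by-phase : Dec (suc s < a) → Dec (s < a) → Dec (suc s < b) → Dec (s < b) → Move (F s) (F (suc s))
      by-phase (yes s+1<a) _ _ _ =
        subst₂ Move (sym (shadow-before a b L' q s (≤-trans (n≤1+n (suc s)) s+1<a))) (sym (shadow-before a b L' q (suc s) s+1<a))
          (proj₂ robber-walk s)
      by-phase (no s+1≮a) (yes s<a) _ _ =
        subst₂ Move (sym (shadow-before a b L' q s s<a)) (cong F (sym s+1≡a)) (enter s (sym s+1≡a))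
        where
        s+1≡a : suc s ≡ a
        s+1≡a = ≤-antisym s<a (≮⇒≥ s+1≮a)
      by-phase (no _) (no s≮a) (yes s+1<b) _ =
        subst₂ Move (sym (shadow-during a b L' q s (≮⇒≥ s≮a) (≤-trans (n≤1+n (suc s)) s+1<b)))
          (sym (shadow-during a b L' q (suc s) (≤-trans (≮⇒≥ s≮a) (n≤1+n s)) s+1<b)) (inj₁ refl)
      by-phase (no _) (no s≮a) (no s+1≮b) (yes s<b) =
        subst₂ Move (sym (shadow-during a b L' q s (≮⇒≥ s≮a) s<b))
          (sym (shadow-after a b L' q (suc s) (≤-trans (≮⇒≥ s≮a) (n≤1+n s)) (≮⇒≥ s+1≮b)))
          (inj₂ (trans (adj-ln-pt q L') (leave (≤-trans (s≤s (≮⇒≥ s≮a)) s<b))))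
      by-phase (no _) (no s≮a) (no s+1≮b) (no s≮b) =
        subst₂ Move (sym (shadow-after a b L' q s (≮⇒≥ s≮a) (≮⇒≥ s≮b)))
          (sym (shadow-after a b L' q (suc s) (≤-trans (≮⇒≥ s≮a) (n≤1+n s)) (≮⇒≥ s+1≮b))) (inj₁ refl)

    Ambiguous : ℕ → Set
    Ambiguous t = Σ (RobberWalk G) λ w →
      (history G σ (proj₁ w) (suc t) ≡ history G σ robber (suc t)) × (proj₁ w t ≢ robber t)

    Entry : ℕ → Pt → Set
    Entry a v = a ≡ 0 ⊎ Σ ℕ λ a' → (a ≡ suc a') × (robber a' ≡ pt v)

    Invariant : ℕ → RobberState → Set
    Invariant t (on-line a v L L' _ _ _) =
      (a ≤ t) × Entry a v × (∀ s → a ≤ s → s ≤ t → readingsAt s (ln L') ≡ readingsAt s (robber s)) × (robber t ≡ ln L)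
    Invariant t (at-point p) = Ambiguous t × (robber t ≡ pt p)

    shadow-enters : ∀ a b L' q v → a < b → v on L' → Entry a v → ∀ a' → a ≡ suc a' → Move (robber a') (shadow a b L' q a)
    shadow-enters a b L' q v a<b vL' (inj₂ (a' , refl , entered)) .a' refl
      rewrite shadow-during (suc a') b L' q (suc a') ≤-refl a<b | entered = inj₂ (trans (adj-pt-ln v L') vL')

    ≤-suc-cases : ∀ {s t} → s ≤ suc t → s ≤ t ⊎ s ≡ suc t
    ≤-suc-cases {s} {t} s≤t+1 with s ≤? t
    ... | yes s≤t = inj₁ s≤t
    ... | no s≰t = inj₂ (≤-antisym s≤t+1 (≰⇒> s≰t))

    shadow-agrees : ∀ t a L' q → (∀ s → a ≤ s → s ≤ t → readingsAt s (ln L') ≡ readingsAt s (robber s)) →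
      ∀ b → t < b → ∀ s → s ≤ t → readingsAt s (shadow a b L' q s) ≡ readingsAt s (robber s)
    shadow-agrees t a L' q twin b t<b s s≤t = by-phase (s <? a)
      where
      by-phase : Dec (s < a) → readingsAt s (shadow a b L' q s) ≡ readingsAt s (robber s)
      by-phase (yes s<a) = cong (readingsAt s) (shadow-before a b L' q s s<a)
      by-phase (no s≮a) =
        trans (cong (readingsAt s) (shadow-during a b L' q s (≮⇒≥ s≮a) (≤-<-trans s≤t t<b))) (twin s (≮⇒≥ s≮a) s≤t)

    invariant⇒ambiguous : ∀ t s → Invariant t s → Ambiguous t
    invariant⇒ambiguous t (at-point p) (ambiguous , _) = ambiguous
    invariant⇒ambiguous t (on-line a v L L' L≢L' vL vL') (a≤t , entry , twin , on-L) =
      (shadow a (suc t) L' v ,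
        shadow-moves a (suc t) L' v (m≤n⇒m≤1+n a≤t) (shadow-enters a (suc t) L' v v (s≤s a≤t) vL' entry) (λ _ → vL')) ,
      history-agrees _ t (shadow-agrees t a L' v twin (suc t) ≤-refl) ,
      λ e → L≢L' (sym (ln-injective (trans (sym (shadow-during a (suc t) L' v t a≤t ≤-refl)) (trans e on-L))))

    invariant-from-point : ∀ t p → Invariant t (at-point p) → (tw : TwinLines p (σ (heard t))) →
      robber (suc t) ≡ position (from-point (suc t) p tw) → Invariant (suc t) (from-point (suc t) p tw)
    invariant-from-point t p (_ , at-p) tw moved = ≤-refl , inj₂ (t , refl , at-p) , twin , moved
      where
      open TwinLines tw
      twin : ∀ s → suc t ≤ s → s ≤ suc t → readingsAt s (ln L') ≡ readingsAt s (robber s)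
      twin s t+1≤s s≤t+1 rewrite ≤-antisym s≤t+1 t+1≤s | moved | readingsAt-suc t (ln L') | readingsAt-suc t (ln L) = sym same

    invariant-from-line : ∀ t a v L L' L≢L' vL vL' → Invariant t (on-line a v L L' L≢L' vL vL') →
      (e : TwinPoints.Escape v L L' L≢L' vL vL' (σ (heard t))) →
      robber (suc t) ≡ position (from-line a v L L' L≢L' vL vL' e) →
      Invariant (suc t) (from-line a v L L' L≢L' vL vL' e)
    invariant-from-line t a v L L' L≢L' vL vL' (a≤t , entry , twin , _) (TwinPoints.stay same) moved =
      m≤n⇒m≤1+n a≤t , entry , twin' , moved
      where
      twin' : ∀ s → a ≤ s → s ≤ suc t → readingsAt s (ln L') ≡ readingsAt s (robber s)
      twin' s a≤s s≤t+1 with ≤-suc-cases s≤t+1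
      ... | inj₁ s≤t = twin s a≤s s≤t
      ... | inj₂ refl rewrite moved | readingsAt-suc t (ln L') | readingsAt-suc t (ln L) = sym same
    invariant-from-line t a v L L' L≢L' vL vL' (a≤t , _ , _ , on-L) (TwinPoints.move p q pL (inj₁ qL) p≢q same) moved =
      ((F , shadow-moves (suc t) (suc t) L' q ≤-refl enter (λ t+1<t+1 → ⊥-elim (<-irrefl refl t+1<t+1))) ,
        history-agrees _ (suc t) agrees , differs) , moved
      where
      F = shadow (suc t) (suc t) L' q
      F-after = shadow-after (suc t) (suc t) L' q (suc t) ≤-refl ≤-refl
      enter : ∀ a' → suc t ≡ suc a' → Move (robber a') (F (suc t))
      enter a' refl rewrite F-after | on-L = inj₂ (trans (adj-ln-pt q L) qL)
      agrees : ∀ s → s ≤ suc t → readingsAt s (F s) ≡ readingsAt s (robber s)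
      agrees s s≤t+1 with ≤-suc-cases s≤t+1
      ... | inj₁ s≤t = cong (readingsAt s) (shadow-before (suc t) (suc t) L' q s (s≤s s≤t))
      ... | inj₂ refl rewrite F-after | moved | readingsAt-suc t (pt q) | readingsAt-suc t (pt p) = sym same
      differs : F (suc t) ≢ robber (suc t)
      differs e = p≢q (sym (pt-injective (trans (sym F-after) (trans e moved))))
    invariant-from-line t a v L L' L≢L' vL vL' (a≤t , entry , twin , _) (TwinPoints.move p q pL (inj₂ qL') p≢q same) moved =
      ((F , shadow-moves a (suc t) L' q (m≤n⇒m≤1+n a≤t) (shadow-enters a (suc t) L' q v (s≤s a≤t) vL' entry) (λ _ → qL')) ,
        history-agrees _ (suc t) agrees , differs) , moved
      where
      F = shadow a (suc t) L' q
      F-after = shadow-after a (suc t) L' q (suc t) (m≤n⇒m≤1+n a≤t) ≤-refl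
      agrees : ∀ s → s ≤ suc t → readingsAt s (F s) ≡ readingsAt s (robber s)
      agrees s s≤t+1 with ≤-suc-cases s≤t+1
      ... | inj₁ s≤t = shadow-agrees t a L' q twin (suc t) ≤-refl s s≤t
      ... | inj₂ refl rewrite F-after | moved | readingsAt-suc t (pt q) | readingsAt-suc t (pt p) = sym same
      differs : F (suc t) ≢ robber (suc t)
      differs e = p≢q (sym (pt-injective (trans (sym F-after) (trans e moved))))

    invariant : ∀ t → Invariant t (state t)
    invariant zero = invariant-start (twin-lines m<k some-point (σ [])) refl
      where
      invariant-start : (tw : TwinLines some-point (σ [])) →
        robber 0 ≡ position (from-point 0 some-point tw) → Invariant 0 (from-point 0 some-point tw)
      invariant-start tw moved = z≤n , inj₁ refl , twin , moved
        where
        open TwinLines tw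
        twin : ∀ s → 0 ≤ s → s ≤ 0 → readingsAt s (ln L') ≡ readingsAt s (robber s)
        twin .0 _ z≤n rewrite moved = sym same
    invariant (suc t) = step (state t) (invariant t) refl
      where
      step : ∀ s → Invariant t s → robber (suc t) ≡ position (respond (suc t) s (σ (heard t))) →
        Invariant (suc t) (respond (suc t) s (σ (heard t)))
      step (at-point p) inv = invariant-from-point t p inv (twin-lines m<k p (σ (heard t)))
      step (on-line a v L L' L≢L' vL vL') inv =
        invariant-from-line t a v L L' L≢L' vL vL' inv (TwinPoints.escape v L L' L≢L' vL vL' m<k (σ (heard t)))

    robber-escapes : ¬ Winning G σ
    robber-escapes win with win robber-walk
    ... | t , located with invariant⇒ambiguous t (state t) (invariant t)
    ...   | w , same-history , elsewhere = elsewhere (located w same-history)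

  lower-bound : ∀ m → m < k → ¬ CopsWin G m
  lower-bound m m<k (σ , win) = Game.robber-escapes m m<k σ win

module Tracking {k : ℕ} (A : AffinePlane k) (2≤k : 2 ≤ k) where
  open Counting
  open Geometry A
  open Distances A 2≤k
  open Readings A 2≤k

  Candidates : Set
  Candidates = V → Bool

  closedAdj : V → V → Bool
  closedAdj u w = ⌊ u ≟ᶠ w ⌋ ∨ adj G u w

  _≡ᵇ_ : ∀ {m} → Vec ℕ m → Vec ℕ m → Bool
  a ≡ᵇ b = ⌊ Vec.≡-dec ℕ._≟_ a b ⌋

  ≡ᵇ-refl : ∀ {m} (a : Vec ℕ m) → a ≡ᵇ a ≡ true
  ≡ᵇ-refl a with Vec.≡-dec ℕ._≟_ a a
  ... | yes _ = refl
  ... | no a≢a = ⊥-elim (a≢a refl)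

  update : ∀ {m} → Vec V m → Vec ℕ m → Candidates → Candidates
  update C o cd w = anyFin (λ u → cd u ∧ closedAdj u w) ∧ (readings C w ≡ᵇ o)

  update-intro : ∀ {m} (C : Vec V m) cd u w → cd u ≡ true → Move u w → update C (readings C w) cd w ≡ true
  update-intro C cd u w cu u→w = ∧-intro (anyFin-intro (λ u' → cd u' ∧ closedAdj u' w) u (∧-intro cu (closed u→w)))
                                          (≡ᵇ-refl (readings C w))
    where
    closed : Move u w → closedAdj u w ≡ true
    closed (inj₁ refl) rewrite ⌊≟⌋-refl u = refl
    closed (inj₂ a) = trans (cong (⌊ u ≟ᶠ w ⌋ ∨_) a) (Bool.∨-zeroʳ _)

  update-from : ∀ {m} {C : Vec V m} {o cd} w → update C o cd w ≡ true →
    Σ V λ u → (cd u ≡ true) × ((u ≡ w) ⊎ (adj G u w ≡ true))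
  update-from {cd = cd} w p with anyFin⇒∃ (λ u → cd u ∧ closedAdj u w) (proj₁ (∧-true p))
  ... | u , q with ∧-true {cd u} q
  ...   | cu , c with u ≟ᶠ w
  ...     | yes u≡w = u , cu , inj₁ u≡w
  ...     | no _ = u , cu , inj₂ c

  update-readings : ∀ {m} {C : Vec V m} {o cd} w → update C o cd w ≡ true → readings C w ≡ o
  update-readings {C = C} {o} {cd} w p with Vec.≡-dec ℕ._≟_ (readings C w) o
  ... | yes same = same
  ... | no _ with () ← trans (sym p) (Bool.∧-zeroʳ _)

  same-readings : ∀ {m} {C : Vec V m} {o cd} w₁ w₂ → update C o cd w₁ ≡ true → update C o cd w₂ ≡ true →
    readings C w₁ ≡ readings C w₂
  same-readings w₁ w₂ p₁ p₂ = trans (update-readings w₁ p₁) (sym (update-readings w₂ p₂))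

  -- a probed candidate reads 0 only at itself, so it cannot share its readings
  probed-excluded : ∀ {m} {C : Vec V m} {o cd c} → c ∈ᵥ C → 2 ≤ count (update C o cd) → update C o cd c ≡ false
  probed-excluded {C = C} {o} {cd} {c} c∈C 2≤ with update C o cd c in uc
  ... | false = refl
  ... | true = ⊥-elim (2≤count⇒¬⊆-singleton (update C o cd) c 2≤ only-c)
    where
    only-c : ∀ w → update C o cd w ≡ true → w ≡ c
    only-c w uw = sym (decode-injective (δ≡0⇒≡ (decode c) (decode w)
      (trans (sym (readings⇒δ≡ c∈C (same-readings c w uc uw))) (δ-refl (decode c)))))

  candPts : Candidates → Pt → Bool
  candPts cd x = cd (pt x)

  candLns : Candidates → Bl → Bool
  candLns cd B = cd (ln B)

  OnPoints OnLines : Candidates → Set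
  OnPoints cd = ∀ w → cd w ≡ true → Σ Pt λ x → w ≡ pt x
  OnLines cd = ∀ w → cd w ≡ true → Σ Bl λ B → w ≡ ln B

  count-points : ∀ cd → OnPoints cd → count cd ≡ count (candPts cd)
  count-points cd on = ≤-antisym
    (count-≤-injection cd (candPts cd) point-of (λ w p → member w p) (λ w₁ w₂ p₁ p₂ e → injective w₁ w₂ p₁ p₂ e))
    (count-≤-injection (candPts cd) cd pt (λ x p → p) (λ x y _ _ e → pt-injective e))
    where
    point-of : V → Pt
    point-of w = [ (λ x → x) , (λ _ → some-point) ]′ (decode w)
    point-of-pt : ∀ x → point-of (pt x) ≡ x
    point-of-pt x rewrite decode-pt x = refl
    member : ∀ w → cd w ≡ true → candPts cd (point-of w) ≡ true
    member w p with on w p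
    ... | x , refl rewrite point-of-pt x = p
    injective : ∀ w₁ w₂ → cd w₁ ≡ true → cd w₂ ≡ true → point-of w₁ ≡ point-of w₂ → w₁ ≡ w₂
    injective w₁ w₂ p₁ p₂ e with on w₁ p₁ | on w₂ p₂
    ... | x , refl | y , refl rewrite point-of-pt x | point-of-pt y = cong pt e

  count-lines : ∀ cd → OnLines cd → count cd ≡ count (candLns cd)
  count-lines cd on = ≤-antisym
    (count-≤-injection cd (candLns cd) line-of (λ w p → member w p) (λ w₁ w₂ p₁ p₂ e → injective w₁ w₂ p₁ p₂ e))
    (count-≤-injection (candLns cd) cd ln (λ x p → p) (λ x y _ _ e → ln-injective e))
    where
    line-of : V → Bl
    line-of w = [ (λ _ → some-line) , (λ B → B) ]′ (decode w)
    line-of-ln : ∀ B → line-of (ln B) ≡ B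
    line-of-ln B rewrite decode-ln B = refl
    member : ∀ w → cd w ≡ true → candLns cd (line-of w) ≡ true
    member w p with on w p
    ... | B , refl rewrite line-of-ln B = p
    injective : ∀ w₁ w₂ → cd w₁ ≡ true → cd w₂ ≡ true → line-of w₁ ≡ line-of w₂ → w₁ ≡ w₂
    injective w₁ w₂ p₁ p₂ e with on w₁ p₁ | on w₂ p₂
    ... | B , refl | C , refl rewrite line-of-ln B | line-of-ln C = cong ln e

  no-points⇒OnLines : ∀ cd → anyFin (candPts cd) ≡ false → OnLines cd
  no-points⇒OnLines cd none w p with point-or-line w
  ... | inj₂ line = line
  ... | inj₁ (x , refl) with () ← trans (sym (anyFin-false⇒∀ (candPts cd) none x)) p

  points-stay : ∀ {m} {C : Vec V m} {o cd} → OnPoints cd → ∀ y → update C o cd (pt y) ≡ true → cd (pt y) ≡ true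
  points-stay on y p with update-from (pt y) p
  ... | u , cu , inj₁ refl = cu
  ... | u , cu , inj₂ a with on u cu
  ...   | x , refl with () ← trans (sym (adj-pt-pt x y)) a

  lines-stay : ∀ {m} {C : Vec V m} {o cd} → OnLines cd → ∀ B → update C o cd (ln B) ≡ true → cd (ln B) ≡ true
  lines-stay on B p with update-from (ln B) p
  ... | u , cu , inj₁ refl = cu
  ... | u , cu , inj₂ a with on u cu
  ...   | M , refl with () ← trans (sym (adj-ln-ln M B)) a

  line-from-point : ∀ {m} {C : Vec V m} {o cd} → OnPoints cd → ∀ B → update C o cd (ln B) ≡ true →
    Σ Pt λ y → (cd (pt y) ≡ true) × y on B
  line-from-point on B p with update-from (ln B) p
  ... | u , cu , moved with on u cu
  ...   | y , refl with moved
  ...     | inj₁ e = ⊥-elim (pt≢ln e)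
  ...     | inj₂ a = y , cu , trans (sym (adj-pt-ln y B)) a

  point-from-line : ∀ {m} {C : Vec V m} {o cd} → OnLines cd → ∀ x → update C o cd (pt x) ≡ true →
    Σ Bl λ B → (cd (ln B) ≡ true) × x on B
  point-from-line on x p with update-from (pt x) p
  ... | u , cu , moved with on u cu
  ...   | B , refl with moved
  ...     | inj₁ e = ⊥-elim (pt≢ln (sym e))
  ...     | inj₂ a = B , cu , trans (sym (adj-ln-pt x B)) a

module CopStrategy {k : ℕ} (A : AffinePlane k) (3≤k : 3 ≤ k) where
  open Counting
  open Selection
  open Geometry A

  2≤k : 2 ≤ k
  2≤k = ≤-trans (n≤1+n 2) 3≤k

  open Distances A 2≤k
  open Readings A 2≤k
  open Tracking A 2≤k

  P : Bl → Bool
  P B = parallel B some-line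

  pickPt : (Pt → Bool) → Pt
  pickPt = firstOr some-point

  pickLn : (Bl → Bool) → Bl
  pickLn = firstOr some-line

  P-line : Pt → Bl
  P-line x = pickLn (λ B → P B ∧ inc A x B)

  P-line-spec : ∀ x → (P (P-line x) ≡ true) × x on P-line x
  P-line-spec x with parallel-cover some-line x
  ... | C , C∥ , xC = ∧-true (firstOr-satisfies some-line (λ B → P B ∧ inc A x B)
                       (∧-intro (trans (cong (λ c → ⌊ c ≟ᶠ cls A some-line ⌋) C∥) (⌊≟⌋-refl (cls A some-line))) xC))

  -- what the cops know about the candidates, besides the candidate set itself
  data Mode : Set where
    start         : Mode
    off-P         : Mode
    points-on     : Bl → Mode
    lines-through : Bl → Pt → Mode

  probes : Mode → Candidates → Vec V k
  probes start cd = padTo k (lmap ln (enumerate P)) (ln some-line)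
  probes off-P cd = padTo k (ln (pickLn (candLns cd)) ∷ lmap ln (enumerate (remove some-line P))) (ln some-line)
  probes (points-on L) cd =
    let x₀ = pickPt (candPts cd) in
    padTo k (lmap pt (enumerate (remove x₀ (candPts cd)))
             ++ (ln L ∷ lmap ln (enumerate (takeFirst (k ∸ count (candPts cd)) (remove L (inc A x₀))))))
          (ln L)
  probes (lines-through L y) cd =
    padTo k (lmap ln (enumerate (remove (pickLn (candLns cd)) (candLns cd)))
             ++ lmap ln (enumerate (takeFirst (suc k ∸ count (candLns cd)) (remove L (λ N → parallel N L)))))
          (ln L)

  nextMode : Mode → Candidates → Mode
  nextMode start cd = if anyFin (candPts cd) then points-on (P-line (pickPt (candPts cd))) else off-P
  nextMode off-P cd = if anyFin (candPts cd) then points-on (P-line (pickPt (candPts cd))) else off-P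
  nextMode (points-on L) cd = lines-through L (pickPt (λ x → inc A x (pickLn (candLns cd)) ∧ inc A x L))
  nextMode (lines-through L y) cd = points-on (pickLn (λ B → inc A y B ∧ inc A (pickPt (candPts cd)) B))

  Invariant : Mode → Candidates → Set
  Invariant start cd = ⊤
  Invariant off-P cd = ∀ w → cd w ≡ true → Σ Bl λ B → (w ≡ ln B) × (P B ≡ false)
  Invariant (points-on L) cd = ∀ w → cd w ≡ true → Σ Pt λ x → (w ≡ pt x) × x on L
  Invariant (lines-through L y) cd =
    y on L × (∀ w → cd w ≡ true → Σ Bl λ B → (w ≡ ln B) × y on B × (B ≢ L)) × (count cd ≤ k)

  -- the start mode is left after the first round, so its potential is never consulted
  potential : Mode → Candidates → ℕ
  potential start cd = 0
  potential off-P cd = 2 * k + 2 + count cd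
  potential (points-on L) cd = 2 * count cd + 1
  potential (lines-through L y) cd = 2 * count cd

  Progress : Mode → Candidates → Vec ℕ k → Set
  Progress md cd o = let cd' = update (probes md cd) o cd in
    2 ≤ count cd' → Invariant (nextMode md cd') cd' × (potential (nextMode md cd') cd' < potential md cd)

  count-P : count P ≡ k
  count-P = class-size some-line

  count-P∖ : suc (count (remove some-line P)) ≡ k
  count-P∖ = trans (sym (count-remove-member P (⌊≟⌋-refl (cls A some-line)))) count-P

  P-probed-at-start : ∀ cd B → P B ≡ true → ln B ∈ᵥ probes start cd
  P-probed-at-start cd B PB = ∈-padTo k (lmap ln (enumerate P)) (ln some-line) (∈-map⁺ ln (∈-enumerate P B PB))
    (≤-reflexive (trans (length-map ln (enumerate P)) (trans (length-enumerate P) count-P)))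

  off-P-probes-length : ∀ cd → length (ln (pickLn (candLns cd)) ∷ lmap ln (enumerate (remove some-line P))) ≤ k
  off-P-probes-length cd = ≤-reflexive (trans (cong suc (trans (length-map ln (enumerate (remove some-line P)))
                             (length-enumerate (remove some-line P)))) count-P∖)

  picked-probed-off-P : ∀ cd → ln (pickLn (candLns cd)) ∈ᵥ probes off-P cd
  picked-probed-off-P cd = ∈-padTo k _ (ln some-line) (here refl) (off-P-probes-length cd)

  P-probed-off-P : ∀ cd B → P B ≡ true → B ≢ some-line → ln B ∈ᵥ probes off-P cd
  P-probed-off-P cd B PB B≢ = ∈-padTo k _ (ln some-line)
    (there (∈-map⁺ ln (∈-enumerate (remove some-line P) B (∧-intro PB (≢⇒≢ᵇ B≢)))))
    (off-P-probes-length cd)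

  -- every line of P is probed except possibly one, and the points of that line are told apart
  -- from the others by all the remaining lines
  same-P-line : ∀ {C : Vec V k} → (∀ B → P B ≡ true → B ≢ some-line → ln B ∈ᵥ C) →
    ∀ x y → readings C (pt x) ≡ readings C (pt y) → y on P-line x
  same-P-line {C} probed x y same with P-line x ≟ᶠ some-line
  ... | no x-probed = δ≡1⇒on (trans (sym (readings-ln-pt (probed (P-line x) (proj₁ (P-line-spec x)) x-probed) same))
                                   (on⇒δ≡1 (proj₂ (P-line-spec x))))
  ... | yes x-unprobed with P-line y ≟ᶠ some-line
  ...   | yes y-unprobed = subst (y on_) (trans y-unprobed (sym x-unprobed)) (proj₂ (P-line-spec y))
  ...   | no y-probed = subst (y on_) (sym P-line-x≡y) (proj₂ (P-line-spec y))
    where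
    x-on-y's : x on P-line y
    x-on-y's = δ≡1⇒on (trans (readings-ln-pt (probed (P-line y) (proj₁ (P-line-spec y)) y-probed) same)
                             (on⇒δ≡1 (proj₂ (P-line-spec y))))
    P-line-x≡y : P-line x ≡ P-line y
    P-line-x≡y with P-line x ≟ᶠ P-line y
    ... | yes e = e
    ... | no ne = ⊥-elim (parallel-disjoint
                    (trans (⌊≟⌋-true (proj₁ (P-line-spec x))) (sym (⌊≟⌋-true (proj₁ (P-line-spec y)))))
                    ne (proj₂ (P-line-spec x)) x-on-y's)

  point-found : ∀ (C : Vec V k) o cd → (∀ B → P B ≡ true → B ≢ some-line → ln B ∈ᵥ C) →
    let cd' = update C o cd in anyFin (candPts cd') ≡ true →
    Invariant (points-on (P-line (pickPt (candPts cd')))) cd' × (count cd' ≤ k)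
  point-found C o cd probed some = inv , bound
    where
    cd' = update C o cd
    x₀ = pickPt (candPts cd')
    x₀∈ : cd' (pt x₀) ≡ true
    x₀∈ = let (x , x∈) = anyFin⇒∃ (candPts cd') some in firstOr-satisfies some-point (candPts cd') x∈
    inv : Invariant (points-on (P-line x₀)) cd'
    inv w p with point-or-line w
    ... | inj₁ (y , refl) = y , refl , same-P-line probed x₀ y (same-readings (pt x₀) (pt y) x₀∈ p)
    ... | inj₂ (B , refl) = ⊥-elim (readings-parity 1≤k C x₀ B (same-readings (pt x₀) (ln B) x₀∈ p))
    on-P-line : ∀ y → candPts cd' y ≡ true → y on P-line x₀
    on-P-line y p = let (_ , e , yL) = inv (pt y) p in subst (_on P-line x₀) (sym (pt-injective e)) yL
    bound : count cd' ≤ k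
    bound = begin
      count cd'                                ≡⟨ count-points cd' (λ w p → let (y , e , _) = inv w p in y , e) ⟩
      count (candPts cd')                      ≤⟨ count-mono on-P-line ⟩
      count (λ y → inc A y (P-line x₀))        ≡⟨ blockSize A (P-line x₀) ⟩
      k                                        ∎
      where open ≤-Reasoning

  everywhere : Candidates
  everywhere _ = true

  start-step : ∀ o → let cd' = update (probes start everywhere) o everywhere in
    2 ≤ count cd' → Invariant (nextMode start cd') cd'
  start-step o 2≤ with anyFin (candPts (update (probes start everywhere) o everywhere)) in some
  ... | true = proj₁ (point-found (probes start everywhere) o everywhere (λ B PB _ → P-probed-at-start everywhere B PB) some)
  ... | false = off-P-lines
    where
    cd' = update (probes start everywhere) o everywhere
    off-P-lines : Invariant off-P cd'
    off-P-lines w p with no-points⇒OnLines cd' some w p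
    ... | B , refl with P B in PB
    ...   | false = B , refl , PB
    ...   | true with () ← trans (sym p) (probed-excluded (P-probed-at-start everywhere B PB) 2≤)

  2n+1+1 : ∀ n → suc (2 * n + 1) ≡ 2 * n + 2
  2n+1+1 = solve-∀

  -- each round either finds the robber on a point, or rules out the probed candidate line
  off-P-progress : ∀ cd o → Invariant off-P cd → Progress off-P cd o
  off-P-progress cd o inv 2≤ with anyFin (candPts (update (probes off-P cd) o cd)) in some
  ... | true = let (inv' , bound) = point-found (probes off-P cd) o cd (P-probed-off-P cd) some in
    inv' , ≤-trans (s≤s (+-monoˡ-≤ 1 (*-monoʳ-≤ 2 bound))) (≤-trans (≤-reflexive (2n+1+1 k)) (m≤m+n (2 * k + 2) (count cd)))
  ... | false = off-P-lines , +-monoʳ-< (2 * k + 2) fewer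
    where
    C = probes off-P cd
    cd' = update C o cd
    on-lines : OnLines cd
    on-lines w p = let (B , e , _) = inv w p in B , e
    off-P-lines : Invariant off-P cd'
    off-P-lines w p with no-points⇒OnLines cd' some w p
    ... | B , refl = inv (ln B) (lines-stay on-lines B p)
    M₀ = pickLn (candLns cd)
    M₀∈ : cd (ln M₀) ≡ true
    M₀∈ with 1≤count⇒∃ {f = cd'} (≤-trans (s≤s z≤n) 2≤)
    ... | w , p with no-points⇒OnLines cd' some w p
    ...   | B , refl = firstOr-satisfies some-line (candLns cd) (lines-stay on-lines B p)
    ⊆cd∖M₀ : ∀ w → cd' w ≡ true → remove (ln M₀) cd w ≡ true
    ⊆cd∖M₀ w p with no-points⇒OnLines cd' some w p
    ... | B , refl with ln B ≟ᶠ ln M₀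
    ...   | yes e with () ← trans (sym p) (trans (cong cd' e) (probed-excluded (picked-probed-off-P cd) 2≤))
    ...   | no _ = ∧-intro (lines-stay on-lines B p) refl
    fewer : count cd' < count cd
    fewer = ≤-trans (s≤s (count-mono ⊆cd∖M₀)) (≤-reflexive (sym (count-remove-member cd M₀∈)))

module PointsStep {k : ℕ} (A : AffinePlane k) (3≤k : 3 ≤ k) where
  open Counting
  open Selection
  open Geometry A
  open CopStrategy A 3≤k
  open Distances A 2≤k
  open Readings A 2≤k
  open Twins A 2≤k using (lineRef-exception-unique)
  open Tracking A 2≤k

  -- at distance 0 or 4 from N, unlike every other line through y
  farLine : Bl → Pt → Bl
  farLine N y = if inc A y N then N else pickLn (λ B → parallel B N ∧ inc A y B)

  farLine-spec : ∀ N y → y on farLine N y × δ (inj₂ N) (inj₂ (farLine N y)) ≢ 2 ×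
    (∀ x → x on N → x on farLine N y → farLine N y ≡ N)
  farLine-spec N y with inc A y N in yN
  ... | true = yN , (λ δNN≡2 → case-0≡2 (trans (sym (δ-refl (inj₂ N))) δNN≡2)) , (λ _ _ _ → refl)
    where
    case-0≡2 : 0 ≢ 2
    case-0≡2 ()
  ... | false = y∈B' , far , (λ x xN xB' → ⊥-elim (disjoint x xN xB'))
    where
    B' = pickLn (λ B → parallel B N ∧ inc A y B)
    B'-spec : (parallel B' N ≡ true) × y on B'
    B'-spec with parallel-cover N y
    ... | C , C∥N , yC = ∧-true (firstOr-satisfies some-line (λ B → parallel B N ∧ inc A y B)
                           (∧-intro (trans (cong (λ c → ⌊ c ≟ᶠ cls A N ⌋) C∥N) (⌊≟⌋-refl (cls A N))) yC))
    y∈B' = proj₂ B'-spec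
    B'≢N : B' ≢ N
    B'≢N B'≡N with () ← trans (sym yN) (subst (y on_) B'≡N y∈B')
    disjoint : ∀ x → x on N → x on B' → ⊥
    disjoint x xN xB' = parallel-disjoint (⌊≟⌋-true (proj₁ B'-spec)) B'≢N xB' xN
    far : δ (inj₂ N) (inj₂ B') ≢ 2
    far δ≡2 with N ≟ᶠ B'
    ... | yes N≡B' = B'≢N (sym N≡B')
    ... | no _ with meets N B' in m
    ...   | true = let (x , xN , xB') = meets-elim m in disjoint x xN xB'
    far () | no _ | false

  -- the candidates are s points of L; probe all but one of them, L itself, and k - s lines
  -- through the remaining point x₀
  module Round (L : Bl) (cd : Candidates) (inv : Invariant (points-on L) cd) (o : Vec ℕ k) where

    C = probes (points-on L) cd
    cd' = update C o cd
    x₀ = pickPt (candPts cd)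
    s = count (candPts cd)
    others = remove x₀ (candPts cd)
    R = takeFirst (k ∸ s) (remove L (inc A x₀))

    on-points : OnPoints cd
    on-points w p = let (x , e , _) = inv w p in x , e

    on-L : ∀ x → cd (pt x) ≡ true → x on L
    on-L x p = let (x' , e , x'L) = inv (pt x) p in subst (_on L) (sym (pt-injective e)) x'L

    s≤k : s ≤ k
    s≤k = ≤-trans (count-mono (λ x p → on-L x p)) (≤-reflexive (blockSize A L))

    R-spec : ∀ N → R N ≡ true → x₀ on N × (N ≢ L)
    R-spec N rN = let (x₀N , N≢L) = ∧-true {inc A x₀ N} (takeFirst-⊆ (k ∸ s) (remove L (inc A x₀)) N rN) in
      x₀N , ≢ᵇ⇒≢ N≢L

    module Nonempty (x₀∈ : cd (pt x₀) ≡ true) where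

      x₀L : x₀ on L
      x₀L = on-L x₀ x₀∈

      count-R : count R ≡ k ∸ s
      count-R = count-takeFirst (k ∸ s) (remove L (inc A x₀)) (≤-trans (m∸n≤m k s) (≤-reflexive (suc-injective lines-at-x₀)))
        where
        lines-at-x₀ : suc k ≡ suc (count (remove L (inc A x₀)))
        lines-at-x₀ = trans (sym (replication A x₀)) (count-remove-member (inc A x₀) x₀L)

      probe-list-length : length (lmap pt (enumerate others) ++ (ln L ∷ lmap ln (enumerate R))) ≤ k
      probe-list-length = ≤-reflexive (begin
        length (lmap pt (enumerate others) ++ (ln L ∷ lmap ln (enumerate R)))
          ≡⟨ length-++ (lmap pt (enumerate others)) ⟩
        length (lmap pt (enumerate others)) + suc (length (lmap ln (enumerate R)))
          ≡⟨ cong₂ (λ a b → a + suc b) (trans (length-map pt (enumerate others)) (length-enumerate others))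
                                       (trans (length-map ln (enumerate R)) (trans (length-enumerate R) count-R)) ⟩
        count others + suc (k ∸ s)
          ≡⟨ +-suc (count others) (k ∸ s) ⟩
        suc (count others) + (k ∸ s)
          ≡⟨ cong (_+ (k ∸ s)) (sym (count-remove-member (candPts cd) x₀∈)) ⟩
        s + (k ∸ s)
          ≡⟨ m+[n∸m]≡n s≤k ⟩
        k ∎)
        where open ≡-Reasoning

      other-probed : ∀ x → others x ≡ true → pt x ∈ᵥ C
      other-probed x p = ∈-padTo k _ (ln L) (∈-++⁺ˡ (∈-map⁺ pt (∈-enumerate others x p))) probe-list-length

      L-probed : ln L ∈ᵥ C
      L-probed = ∈-padTo k _ (ln L) (∈-++⁺ʳ (lmap pt (enumerate others)) (here refl)) probe-list-length

      R-probed : ∀ N → R N ≡ true → ln N ∈ᵥ C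
      R-probed N p = ∈-padTo k _ (ln L) (∈-++⁺ʳ (lmap pt (enumerate others)) (there (∈-map⁺ ln (∈-enumerate R N p))))
                       probe-list-length

      module Crowded (2≤ : 2 ≤ count cd') where

        excluded : ∀ {c} → c ∈ᵥ C → cd' c ≡ false
        excluded c∈C = probed-excluded c∈C 2≤

        point⇒x₀ : ∀ y → cd' (pt y) ≡ true → y ≡ x₀
        point⇒x₀ y p with y ≟ᶠ x₀
        ... | yes y≡x₀ = y≡x₀
        ... | no y≢x₀ with () ←
          trans (sym p) (excluded (other-probed y (∧-intro (points-stay on-points y p) (≢⇒≢ᵇ y≢x₀))))

        no-point : ∀ y → cd' (pt y) ≡ false
        no-point y with cd' (pt y) in p
        ... | false = refl
        ... | true = ⊥-elim (2≤count⇒¬⊆-singleton cd' (pt y) 2≤ only-y)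
          where
          only-y : ∀ w → cd' w ≡ true → w ≡ pt y
          only-y w q with point-or-line w
          ... | inj₂ (B , refl) = ⊥-elim (readings-parity 1≤k C y B (same-readings (pt y) (ln B) p q))
          ... | inj₁ (y' , refl) = cong pt (trans (point⇒x₀ y' q) (sym (point⇒x₀ y p)))

        on-lines : OnLines cd'
        on-lines w p with point-or-line w
        ... | inj₂ line = line
        ... | inj₁ (y , refl) with () ← trans (sym p) (no-point y)

        ≢L : ∀ B → cd' (ln B) ≡ true → B ≢ L
        ≢L B p refl with () ← trans (sym p) (excluded L-probed)

        origin : ∀ B → cd' (ln B) ≡ true → Σ Pt λ y → (cd (pt y) ≡ true) × y on B
        origin = line-from-point on-points

        -- a probed origin lies on both candidate lines, which would then meet L twice
        probed-origin : ∀ Bᵢ Bⱼ yᵢ yⱼ → cd' (ln Bᵢ) ≡ true → cd' (ln Bⱼ) ≡ true → cd (pt yᵢ) ≡ true →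
          yᵢ on Bᵢ → yⱼ on Bⱼ → yⱼ on L → yᵢ ≢ x₀ → yᵢ ≢ yⱼ → ⊥
        probed-origin Bᵢ Bⱼ yᵢ yⱼ pᵢ pⱼ cᵢ yᵢBᵢ yⱼBⱼ yⱼL yᵢ≢x₀ yᵢ≢yⱼ =
          ≢L Bⱼ pⱼ (line-unique yᵢ≢yⱼ yᵢBⱼ yⱼBⱼ (on-L yᵢ cᵢ) yⱼL)
          where
          yᵢBⱼ : yᵢ on Bⱼ
          yᵢBⱼ = δ≡1⇒on (trans (sym (readings-pt-ln (other-probed yᵢ (∧-intro cᵢ (≢⇒≢ᵇ yᵢ≢x₀)))
                                                      (same-readings (ln Bᵢ) (ln Bⱼ) pᵢ pⱼ)))
                                (on⇒δ≡1 yᵢBᵢ))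

        origins-agree : ∀ B₁ B₂ y₁ y₂ → cd' (ln B₁) ≡ true → cd' (ln B₂) ≡ true →
          cd (pt y₁) ≡ true → cd (pt y₂) ≡ true → y₁ on B₁ → y₂ on B₂ → y₁ ≡ y₂
        origins-agree B₁ B₂ y₁ y₂ p₁ p₂ c₁ c₂ y₁B₁ y₂B₂ with y₁ ≟ᶠ y₂
        ... | yes y₁≡y₂ = y₁≡y₂
        ... | no y₁≢y₂ with y₁ ≟ᶠ x₀
        ...   | no y₁≢x₀ =
          ⊥-elim (probed-origin B₁ B₂ y₁ y₂ p₁ p₂ c₁ y₁B₁ y₂B₂ (on-L y₂ c₂) y₁≢x₀ y₁≢y₂)
        ...   | yes y₁≡x₀ = ⊥-elim (probed-origin B₂ B₁ y₂ y₁ p₂ p₁ c₂ y₂B₂ y₁B₁ (on-L y₁ c₁)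
                               (λ y₂≡x₀ → y₁≢y₂ (trans y₁≡x₀ (sym y₂≡x₀))) (λ y₂≡y₁ → y₁≢y₂ (sym y₂≡y₁)))

        B₁ = pickLn (candLns cd')
        y = pickPt (λ x → inc A x B₁ ∧ inc A x L)

        B₁∈ : cd' (ln B₁) ≡ true
        B₁∈ with 1≤count⇒∃ {f = cd'} (≤-trans (s≤s z≤n) 2≤)
        ... | w , p with on-lines w p
        ...   | B , refl = firstOr-satisfies some-line (candLns cd') p

        y-spec : y on B₁ × y on L
        y-spec = let (y₁ , c₁ , y₁B₁) = origin B₁ B₁∈ in
          ∧-true (firstOr-satisfies some-point (λ x → inc A x B₁ ∧ inc A x L) (∧-intro y₁B₁ (on-L y₁ c₁)))

        through-y : ∀ B → cd' (ln B) ≡ true → y on B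
        through-y B p =
          let (y₁ , c₁ , y₁B₁) = origin B₁ B₁∈ ; (yB , cB , yBB) = origin B p in
          subst (_on B) (sym (trans (meet-unique (proj₁ y-spec) y₁B₁ (proj₂ y-spec) (on-L y₁ c₁) (≢L B₁ B₁∈))
                                    (origins-agree B₁ B y₁ yB B₁∈ p c₁ cB y₁B₁ yBB))) yBB

        distant : Bl → Bl → Bool
        distant N B = δ (inj₂ N) (inj₂ B) ≠ᵇ 2

        -- a candidate line at distance other than 2 from a probe N ∈ R would be the only one
        not-distant : ∀ N B → R N ≡ true → cd' (ln B) ≡ true → distant N B ≡ false
        not-distant N B rN p with distant N B in d
        ... | false = refl
        ... | true = ⊥-elim (2≤count⇒¬⊆-singleton cd' (ln B) 2≤ only-B)
          where
          only-B : ∀ w → cd' w ≡ true → w ≡ ln B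
          only-B w q with on-lines w q
          ... | B' , refl = cong ln (lineRef-exception-unique y (inj₂ N) B' B (through-y B' q) (through-y B p)
                              (λ δ≡2 → ≠ᵇ⇒≢ d (trans (readings-ln-ln (R-probed N rN) (same-readings (ln B) (ln B') p q))
                                                     δ≡2))
                              (≠ᵇ⇒≢ d))

        lines-at-y near-R : Bl → Bool
        lines-at-y = remove L (inc A y)
        near-R B = anyFin (λ N → R N ∧ distant N B)

        candidate⇒far-from-R : ∀ B → candLns cd' B ≡ true → lines-at-y B ∧ not (near-R B) ≡ true
        candidate⇒far-from-R B p = ∧-intro (∧-intro (through-y B p) (≢⇒≢ᵇ (≢L B p)))
          (cong not (∀⇒anyFin-false (λ N → R N ∧ distant N B) none))
          where
          none : ∀ N → R N ∧ distant N B ≡ false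
          none N with R N in rN
          ... | false = refl
          ... | true = not-distant N B rN p

        farLine-near : ∀ N → R N ≡ true → lines-at-y (farLine N y) ∧ near-R (farLine N y) ≡ true
        farLine-near N rN = ∧-intro (∧-intro y∈F (≢⇒≢ᵇ F≢L))
                                    (anyFin-intro (λ N' → R N' ∧ distant N' (farLine N y)) N (∧-intro rN (≢⇒≠ᵇ far)))
          where
          y∈F = proj₁ (farLine-spec N y)
          far = proj₁ (proj₂ (farLine-spec N y))
          F≢L : farLine N y ≢ L
          F≢L F≡L = proj₂ (R-spec N rN)
            (trans (sym (proj₂ (proj₂ (farLine-spec N y)) x₀ (proj₁ (R-spec N rN)) (subst (x₀ on_) (sym F≡L) x₀L))) F≡L)

        -- R ∋ N ↦ farLine N y is injective: N is the line through x₀ far from it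
        farLine-injective : ∀ N₁ N₂ → R N₁ ≡ true → R N₂ ≡ true → farLine N₁ y ≡ farLine N₂ y → N₁ ≡ N₂
        farLine-injective N₁ N₂ r₁ r₂ e =
          lineRef-exception-unique x₀ (inj₂ (farLine N₁ y)) N₁ N₂ (proj₁ (R-spec N₁ r₁)) (proj₁ (R-spec N₂ r₂))
            (λ δ≡2 → proj₁ (proj₂ (farLine-spec N₁ y)) (trans (δ-line-line-sym N₁ (farLine N₁ y)) δ≡2))
            (λ δ≡2 → proj₁ (proj₂ (farLine-spec N₂ y))
                       (trans (δ-line-line-sym N₂ (farLine N₂ y))
                              (trans (cong (λ F → δ (inj₂ F) (inj₂ N₂)) (sym e)) δ≡2)))

        count-lines-at-y : count lines-at-y ≡ k
        count-lines-at-y = suc-injective (trans (sym (count-remove-member (inc A y) (proj₂ y-spec))) (replication A y))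

        fewer : count cd' ≤ s
        fewer = +-cancelˡ-≤ (k ∸ s) _ _ (begin
          k ∸ s + count cd'                                                    ≡⟨ cong (k ∸ s +_) (count-lines cd' on-lines) ⟩
          k ∸ s + count (candLns cd')                                          ≤⟨ +-mono-≤ (≤-trans (≤-reflexive (sym count-R)) R↪near)
                                                                                             (count-mono candidate⇒far-from-R) ⟩
          count (λ B → lines-at-y B ∧ near-R B) + count (λ B → lines-at-y B ∧ not (near-R B))
                                                                               ≡⟨ sym (count-split lines-at-y near-R) ⟩
          count lines-at-y                                                     ≡⟨ count-lines-at-y ⟩
          k                                                                    ≡⟨ sym (m∸n+n≡m s≤k) ⟩
          k ∸ s + s                                                            ∎)
          where
          open ≤-Reasoning
          R↪near = count-≤-injection R (λ B → lines-at-y B ∧ near-R B) (λ N → farLine N y) farLine-near farLine-injective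

  points-progress : ∀ L cd o → Invariant (points-on L) cd → Progress (points-on L) cd o
  points-progress L cd o inv 2≤ = invariant' , smaller
    where
    open Round L cd inv o
    x₀∈ : cd (pt x₀) ≡ true
    x₀∈ with 1≤count⇒∃ {f = cd'} (≤-trans (s≤s z≤n) 2≤)
    ... | w , p with update-from w p
    ...   | u , cu , _ with inv u cu
    ...     | x , refl , _ = firstOr-satisfies some-point (candPts cd) cu
    open Nonempty x₀∈
    open Crowded 2≤
    invariant' : Invariant (lines-through L y) cd'
    invariant' = proj₂ y-spec ,
      (λ w p → let (B , e) = on-lines w p ; pB = subst (λ z → cd' z ≡ true) e p in B , e , through-y B pB , ≢L B pB) ,
      ≤-trans fewer s≤k
    smaller : suc (2 * count cd') ≤ 2 * count cd + 1
    smaller = ≤-trans (≤-reflexive (+-comm 1 (2 * count cd')))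
                (+-monoˡ-≤ 1 (*-monoʳ-≤ 2 (≤-trans fewer (≤-reflexive (sym (count-points cd on-points))))))

module PencilStep {k : ℕ} (A : AffinePlane k) (3≤k : 3 ≤ k) where
  open Counting
  open Selection
  open Geometry A
  open CopStrategy A 3≤k
  open Distances A 2≤k
  open Readings A 2≤k
  open Tracking A 2≤k

  -- the candidates are m lines through y ∈ L; probe all but one of them and k + 1 - m lines
  -- parallel to L
  module Round (L : Bl) (y : Pt) (cd : Candidates) (inv : Invariant (lines-through L y) cd) (o : Vec ℕ k) where

    C = probes (lines-through L y) cd
    cd' = update C o cd
    B₀ = pickLn (candLns cd)
    m = count (candLns cd)
    others = remove B₀ (candLns cd)
    parallels = remove L (λ N → parallel N L)
    Par = takeFirst (suc k ∸ m) parallels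

    yL : y on L
    yL = proj₁ inv

    on-lines : OnLines cd
    on-lines w p = let (B , e , _) = proj₁ (proj₂ inv) w p in B , e

    candidate-line : ∀ B → cd (ln B) ≡ true → y on B × (B ≢ L)
    candidate-line B p = let (B' , e , yB' , B'≢L) = proj₁ (proj₂ inv) (ln B) p ; B≡B' = ln-injective e in
      subst (y on_) (sym B≡B') yB' , (λ B≡L → B'≢L (trans (sym B≡B') B≡L))

    m≤k : m ≤ k
    m≤k = ≤-trans (≤-reflexive (sym (count-lines cd on-lines))) (proj₂ (proj₂ inv))

    count-parallels : suc (count parallels) ≡ k
    count-parallels = trans (sym (count-remove-member (λ N → parallel N L) (⌊≟⌋-refl (cls A L)))) (class-size L)

    Par⊆parallels : ∀ N → Par N ≡ true → parallels N ≡ true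
    Par⊆parallels = takeFirst-⊆ (suc k ∸ m) parallels

    y∉parallel : ∀ N → parallels N ≡ true → inc A y N ≡ false
    y∉parallel N p with inc A y N in yN
    ... | false = refl
    ... | true = let (N∥L , N≢L) = ∧-true {parallel N L} p in
      ⊥-elim (parallel-disjoint (⌊≟⌋-true N∥L) (≢ᵇ⇒≢ N≢L) yN yL)

    module Nonempty (B₀∈ : cd (ln B₀) ≡ true) where

      probe-list-length : length (lmap ln (enumerate others) ++ lmap ln (enumerate Par)) ≤ k
      probe-list-length = begin
        length (lmap ln (enumerate others) ++ lmap ln (enumerate Par))
          ≡⟨ length-++ (lmap ln (enumerate others)) ⟩
        length (lmap ln (enumerate others)) + length (lmap ln (enumerate Par))
          ≡⟨ cong₂ _+_ (trans (length-map ln (enumerate others)) (length-enumerate others))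
                       (trans (length-map ln (enumerate Par)) (length-enumerate Par)) ⟩
        count others + count Par
          ≤⟨ +-monoʳ-≤ (count others) (count-takeFirst-≤ (suc k ∸ m) parallels) ⟩
        count others + (suc k ∸ m)
          ≡⟨ cong (λ c → c + (suc k ∸ m)) (cong pred (sym (count-remove-member (candLns cd) B₀∈))) ⟩
        pred m + (suc k ∸ m)
          ≡⟨ pred+[suc∸]≡ m k (1≤count (candLns cd) B₀∈) m≤k ⟩
        k ∎
        where
        open ≤-Reasoning
        pred+[suc∸]≡ : ∀ m k → 1 ≤ m → m ≤ k → pred m + (suc k ∸ m) ≡ k
        pred+[suc∸]≡ (suc m) k _ m+1≤k = m+[n∸m]≡n (≤-trans (n≤1+n m) m+1≤k)

      other-probed : ∀ B → others B ≡ true → ln B ∈ᵥ C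
      other-probed B p = ∈-padTo k _ (ln L) (∈-++⁺ˡ (∈-map⁺ ln (∈-enumerate others B p))) probe-list-length

      Par-probed : ∀ N → Par N ≡ true → ln N ∈ᵥ C
      Par-probed N p = ∈-padTo k _ (ln L) (∈-++⁺ʳ (lmap ln (enumerate others)) (∈-map⁺ ln (∈-enumerate Par N p)))
                         probe-list-length

      few-candidates⇒all-parallels-probed : m ≤ 2 → ∀ N → parallels N ≡ true → Par N ≡ true
      few-candidates⇒all-parallels-probed m≤2 N p =
        trans (takeFirst-all (suc k ∸ m) parallels (k-1≤ m≤2 count-parallels) N) p
        where
        k-1≤ : ∀ {m c k} → m ≤ 2 → suc c ≡ k → c ≤ suc k ∸ m
        k-1≤ {m} {c} m≤2 refl = ∸-monoʳ-≤ (suc (suc c)) m≤2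

      module Crowded (2≤ : 2 ≤ count cd') where

        excluded : ∀ {c} → c ∈ᵥ C → cd' c ≡ false
        excluded c∈C = probed-excluded c∈C 2≤

        line⇒B₀ : ∀ B → cd' (ln B) ≡ true → B ≡ B₀
        line⇒B₀ B p with B ≟ᶠ B₀
        ... | yes B≡B₀ = B≡B₀
        ... | no B≢B₀ with () ←
          trans (sym p) (excluded (other-probed B (∧-intro (lines-stay on-lines B p) (≢⇒≢ᵇ B≢B₀))))

        no-line : ∀ B → cd' (ln B) ≡ false
        no-line B = 2≤count⇒¬alone cd' (ln B) 2≤ only-B
          where
          only-B : cd' (ln B) ≡ true → ∀ w → cd' w ≡ true → w ≡ ln B
          only-B p w q with point-or-line w
          ... | inj₁ (x , refl) = ⊥-elim (readings-parity 1≤k C x B (same-readings (pt x) (ln B) q p))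
          ... | inj₂ (B' , refl) = cong ln (trans (line⇒B₀ B' q) (sym (line⇒B₀ B p)))

        on-points : OnPoints cd'
        on-points w p with point-or-line w
        ... | inj₁ point = point
        ... | inj₂ (B , refl) with () ← trans (sym p) (no-line B)

        source : ∀ x → cd' (pt x) ≡ true → Σ Bl λ B → (cd (ln B) ≡ true) × x on B
        source = point-from-line on-lines

        -- y shares its readings with no other point: a second probed candidate line through y
        -- would contain both, and without one every line parallel to L is probed
        same-as-y⇒y : ∀ x B → cd (ln B) ≡ true → x on B → cd' (pt y) ≡ true → cd' (pt x) ≡ true → x ≡ y
        same-as-y⇒y x B B∈ xB py p with x ≟ᶠ y
        ... | yes x≡y = x≡y
        ... | no x≢y = ⊥-elim (by-second-line (find (λ B' → others B' ∧ B' ≢ᵇ B)))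
          where
          same : readings C (pt y) ≡ readings C (pt x)
          same = same-readings (pt y) (pt x) py p
          by-second-line : (∃ λ B' → others B' ∧ B' ≢ᵇ B ≡ true) ⊎ (∀ B' → others B' ∧ B' ≢ᵇ B ≡ false) → ⊥
          by-second-line (inj₁ (B' , q)) =
            let (oB' , B'≢B) = ∧-true {others B'} q
                yB' = proj₁ (candidate-line B' (proj₁ (∧-true {candLns cd B'} oB')))
                xB' = δ≡1⇒on (trans (sym (readings-ln-pt (other-probed B' oB') same)) (on⇒δ≡1 yB'))
            in x≢y (meet-unique xB' yB' xB (proj₁ (candidate-line B B∈)) (≢ᵇ⇒≢ B'≢B))
          by-second-line (inj₂ none) = y-on-Nx? (inc A y Nx) refl
            where
            only-B : ∀ B' → others B' ≡ true → B' ≡ B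
            only-B B' o with B' ≟ᶠ B
            ... | yes B'≡B = B'≡B
            ... | no B'≢B with () ← trans (sym (none B')) (∧-intro o (≢⇒≢ᵇ B'≢B))
            m≤2 : m ≤ 2
            m≤2 = ≤-trans (≤-reflexive (count-remove-member (candLns cd) B₀∈))
                          (s≤s (count≤1 others (λ a b pa pb → trans (only-B a pa) (sym (only-B b pb)))))
            Nx = proj₁ (parallel-cover L x)
            xNx = proj₂ (proj₂ (parallel-cover L x))
            Nx∈ : parallels Nx ≡ true
            Nx∈ = ∧-intro (trans (cong (λ c → ⌊ c ≟ᶠ cls A L ⌋) (proj₁ (proj₂ (parallel-cover L x)))) (⌊≟⌋-refl (cls A L)))
                          (≢⇒≢ᵇ (λ Nx≡L → proj₂ (candidate-line B B∈)
                                   (line-unique x≢y xB (proj₁ (candidate-line B B∈)) (subst (x on_) Nx≡L xNx) yL)))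
            Nx-probed = few-candidates⇒all-parallels-probed m≤2 Nx Nx∈
            y-on-Nx? : ∀ b → inc A y Nx ≡ b → ⊥
            y-on-Nx? true yNx with () ← trans (sym (y∉parallel Nx Nx∈)) yNx
            y-on-Nx? false yNx with () ← trans (sym (trans (readings-ln-pt (Par-probed Nx Nx-probed) same) (on⇒δ≡1 xNx)))
                                               (cong (λ b → if b then 1 else 3) yNx)

        y-excluded : cd' (pt y) ≡ false
        y-excluded = 2≤count⇒¬alone cd' (pt y) 2≤ only-y
          where
          only-y : cd' (pt y) ≡ true → ∀ w → cd' w ≡ true → w ≡ pt y
          only-y py w p with on-points w p
          ... | x , refl = let (B , B∈ , xB) = source x p in cong pt (same-as-y⇒y x B B∈ xB py p)

        ≢y : ∀ x → cd' (pt x) ≡ true → x ≢ y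
        ≢y x p refl with () ← trans (sym p) y-excluded

        -- a probed source line contains both points, which then lie on two lines through y
        probed-source : ∀ xᵢ xⱼ Bᵢ Bⱼ → cd' (pt xᵢ) ≡ true → cd' (pt xⱼ) ≡ true →
          cd (ln Bᵢ) ≡ true → cd (ln Bⱼ) ≡ true →
          xᵢ on Bᵢ → xⱼ on Bⱼ → Bᵢ ≢ B₀ → Bᵢ ≢ Bⱼ → ⊥
        probed-source xᵢ xⱼ Bᵢ Bⱼ pᵢ pⱼ cᵢ cⱼ xᵢBᵢ xⱼBⱼ Bᵢ≢B₀ Bᵢ≢Bⱼ =
          ≢y xⱼ pⱼ (meet-unique xⱼBᵢ (proj₁ (candidate-line Bᵢ cᵢ)) xⱼBⱼ (proj₁ (candidate-line Bⱼ cⱼ)) Bᵢ≢Bⱼ)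
          where
          xⱼBᵢ : xⱼ on Bᵢ
          xⱼBᵢ = δ≡1⇒on (trans (sym (readings-ln-pt (other-probed Bᵢ (∧-intro cᵢ (≢⇒≢ᵇ Bᵢ≢B₀)))
                                                      (same-readings (pt xᵢ) (pt xⱼ) pᵢ pⱼ)))
                                (on⇒δ≡1 xᵢBᵢ))

        sources-agree : ∀ x₁ x₂ B₁ B₂ → cd' (pt x₁) ≡ true → cd' (pt x₂) ≡ true →
          cd (ln B₁) ≡ true → cd (ln B₂) ≡ true → x₁ on B₁ → x₂ on B₂ → B₁ ≡ B₂
        sources-agree x₁ x₂ B₁ B₂ p₁ p₂ c₁ c₂ x₁B₁ x₂B₂ with B₁ ≟ᶠ B₂
        ... | yes B₁≡B₂ = B₁≡B₂
        ... | no B₁≢B₂ with B₁ ≟ᶠ B₀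
        ...   | no B₁≢B₀ = ⊥-elim (probed-source x₁ x₂ B₁ B₂ p₁ p₂ c₁ c₂ x₁B₁ x₂B₂ B₁≢B₀ B₁≢B₂)
        ...   | yes B₁≡B₀ = ⊥-elim (probed-source x₂ x₁ B₂ B₁ p₂ p₁ c₂ c₁ x₂B₂ x₁B₁
                               (λ B₂≡B₀ → B₁≢B₂ (trans B₁≡B₀ (sym B₂≡B₀))) (λ B₂≡B₁ → B₁≢B₂ (sym B₂≡B₁)))

        -- every candidate reading like x from N lies on N and on the source line of x,
        -- which meets N only at x
        off-probed-parallels′ : ∀ x x' N Bx Bx' → cd' (pt x) ≡ true → cd' (pt x') ≡ true → Par N ≡ true →
          x on N → cd (ln Bx) ≡ true → cd (ln Bx') ≡ true → x on Bx → x' on Bx' → x' ≡ x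
        off-probed-parallels′ x x' N Bx Bx' p p' pN xN cx cx' xBx x'Bx' with x' ≟ᶠ x
        ... | yes x'≡x = x'≡x
        ... | no x'≢x = ⊥-elim (y∉N (subst (y on_) (sym N≡Bx) (proj₁ (candidate-line Bx cx))))
          where
          x'N : x' on N
          x'N = δ≡1⇒on (trans (sym (readings-ln-pt (Par-probed N pN) (same-readings (pt x) (pt x') p p'))) (on⇒δ≡1 xN))
          N≡Bx : N ≡ Bx
          N≡Bx = line-unique x'≢x x'N xN (subst (x' on_) (sym (sources-agree x x' Bx Bx' p p' cx cx' xBx x'Bx')) x'Bx') xBx
          y∉N : ¬ (y on N)
          y∉N yN = case-false (trans (sym (y∉parallel N (Par⊆parallels N pN))) yN)
            where
            case-false : false ≢ true
            case-false ()

        off-probed-parallels : ∀ x N → cd' (pt x) ≡ true → Par N ≡ true → inc A x N ≡ false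
        off-probed-parallels x N p pN with inc A x N in xN
        ... | false = refl
        ... | true = ⊥-elim (2≤count⇒¬⊆-singleton cd' (pt x) 2≤ only-x)
          where
          only-x : ∀ w → cd' w ≡ true → w ≡ pt x
          only-x w p' with on-points w p'
          ... | x' , refl = let (Bx , cx , xBx) = source x p ; (Bx' , cx' , x'Bx') = source x' p' in
            cong pt (off-probed-parallels′ x x' N Bx Bx' p p' pN xN cx cx' xBx x'Bx')

        x₁ = pickPt (candPts cd')
        R = pickLn (λ B → inc A y B ∧ inc A x₁ B)

        x₁∈ : cd' (pt x₁) ≡ true
        x₁∈ with 1≤count⇒∃ {f = cd'} (≤-trans (s≤s z≤n) 2≤)
        ... | w , p with on-points w p
        ...   | x , refl = firstOr-satisfies some-point (candPts cd') p

        R-through : ∀ B → cd (ln B) ≡ true → x₁ on B → y on R × x₁ on R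
        R-through B B∈ x₁B = ∧-true (firstOr-satisfies some-line (λ B → inc A y B ∧ inc A x₁ B)
                                       (∧-intro (proj₁ (candidate-line B B∈)) x₁B))

        R-is-source : ∀ B → cd (ln B) ≡ true → x₁ on B → R ≡ B
        R-is-source B B∈ x₁B = let (yR , x₁R) = R-through B B∈ x₁B in
          line-unique (≢y x₁ x₁∈) x₁R yR x₁B (proj₁ (candidate-line B B∈))

        on-R′ : ∀ x B₁ Bx → cd' (pt x) ≡ true → cd (ln B₁) ≡ true → cd (ln Bx) ≡ true →
          x₁ on B₁ → x on Bx → x on R
        on-R′ x B₁ Bx p c₁ cx x₁B₁ xBx =
          subst (x on_) (sym (trans (R-is-source B₁ c₁ x₁B₁) (sources-agree x₁ x B₁ Bx x₁∈ p c₁ cx x₁B₁ xBx))) xBx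

        on-R : ∀ x → cd' (pt x) ≡ true → x on R
        on-R x p = let (B₁ , c₁ , x₁B₁) = source x₁ x₁∈ ; (Bx , cx , xBx) = source x p in
          on-R′ x B₁ Bx p c₁ cx x₁B₁ xBx

        R≢L : R ≢ L
        R≢L R≡L = let (B₁ , c₁ , x₁B₁) = source x₁ x₁∈ in
          proj₂ (candidate-line B₁ c₁) (trans (sym (R-is-source B₁ c₁ x₁B₁)) R≡L)

        yR : y on R
        yR = let (B₁ , c₁ , x₁B₁) = source x₁ x₁∈ in proj₁ (R-through B₁ c₁ x₁B₁)

        -- R ≠ L passes through y ∈ L, so it is not parallel to L
        R-meets : ∀ N → parallels N ≡ true → meets R N ≡ true
        R-meets N p with meets R N in RN
        ... | true = refl
        ... | false = ⊥-elim (R≢L (playfair (y∉parallel N p) yR yL RN L-misses-N))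
          where
          L-misses-N : meets L N ≡ false
          L-misses-N with meets L N in LN
          ... | false = refl
          ... | true = let (z , zL , zN) = meets-elim LN ; (N∥L , N≢L) = ∧-true {parallel N L} p in
            ⊥-elim (parallel-disjoint (⌊≟⌋-true N∥L) (≢ᵇ⇒≢ N≢L) zN zL)

        crossing : Bl → Pt
        crossing N = pickPt (λ x → inc A x R ∧ inc A x N)

        crossing-spec : ∀ N → parallels N ≡ true → crossing N on R × crossing N on N
        crossing-spec N p = let (z , zR , zN) = meets-elim (R-meets N p) in
          ∧-true (firstOr-satisfies some-point (λ x → inc A x R ∧ inc A x N) (∧-intro zR zN))

        R∖y covered : Pt → Bool
        R∖y = remove y (λ x → inc A x R)
        covered x = anyFin (λ N → Par N ∧ inc A x N)

        candidate⇒uncovered : ∀ x → candPts cd' x ≡ true → R∖y x ∧ not (covered x) ≡ true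
        candidate⇒uncovered x p = ∧-intro (∧-intro (on-R x p) (≢⇒≢ᵇ (≢y x p)))
          (cong not (∀⇒anyFin-false (λ N → Par N ∧ inc A x N) off))
          where
          off : ∀ N → Par N ∧ inc A x N ≡ false
          off N with Par N in pN
          ... | false = refl
          ... | true = off-probed-parallels x N p pN

        crossing-covered : ∀ N → Par N ≡ true → R∖y (crossing N) ∧ covered (crossing N) ≡ true
        crossing-covered N pN = let (zR , zN) = crossing-spec N (Par⊆parallels N pN) in
          ∧-intro (∧-intro zR (≢⇒≢ᵇ (λ z≡y → off-N (subst (_on N) z≡y zN))))
                  (anyFin-intro (λ N' → Par N' ∧ inc A (crossing N) N') N (∧-intro pN zN))
          where
          off-N : ¬ (y on N)
          off-N yN with () ← trans (sym (y∉parallel N (Par⊆parallels N pN))) yN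

        crossing-injective : ∀ N₁ N₂ → Par N₁ ≡ true → Par N₂ ≡ true → crossing N₁ ≡ crossing N₂ → N₁ ≡ N₂
        crossing-injective N₁ N₂ p₁ p₂ e with N₁ ≟ᶠ N₂
        ... | yes N₁≡N₂ = N₁≡N₂
        ... | no N₁≢N₂ =
          let (N₁∥L , _) = ∧-true {parallel N₁ L} (Par⊆parallels N₁ p₁)
              (N₂∥L , _) = ∧-true {parallel N₂ L} (Par⊆parallels N₂ p₂) in
          ⊥-elim (parallel-disjoint (trans (⌊≟⌋-true N₁∥L) (sym (⌊≟⌋-true N₂∥L))) N₁≢N₂
                    (proj₂ (crossing-spec N₁ (Par⊆parallels N₁ p₁)))
                    (subst (_on N₂) (sym e) (proj₂ (crossing-spec N₂ (Par⊆parallels N₂ p₂)))))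

        fewer : suc (count cd' + count Par) ≤ k
        fewer = begin-strict
          count cd' + count Par
            ≡⟨ cong (_+ count Par) (count-points cd' on-points) ⟩
          count (candPts cd') + count Par
            ≤⟨ +-mono-≤ (count-mono candidate⇒uncovered)
                        (count-≤-injection Par (λ x → R∖y x ∧ covered x) crossing crossing-covered crossing-injective) ⟩
          count (λ x → R∖y x ∧ not (covered x)) + count (λ x → R∖y x ∧ covered x)
            ≡⟨ +-comm _ (count (λ x → R∖y x ∧ covered x)) ⟩
          count (λ x → R∖y x ∧ covered x) + count (λ x → R∖y x ∧ not (covered x))
            ≡⟨ sym (count-split R∖y covered) ⟩
          count R∖y
            <⟨ ≤-reflexive (sym (trans (sym (blockSize A R)) (count-remove-member (λ x → inc A x R) yR))) ⟩
          k ∎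
          where open ≤-Reasoning

  private
    no-room : ∀ {c p k} → suc (c + p) ≤ k → suc p ≡ k → c ≡ 0
    no-room {zero} _ _ = refl
    no-room {suc c} {p} (s≤s c+1+p<p+1) refl = ⊥-elim (<-irrefl refl (≤-trans (s≤s (m≤n+m p c)) c+1+p<p+1))

    two-fewer : ∀ {c m k} → suc (c + (suc k ∸ m)) ≤ k → m ≤ k → suc (2 * c + 1) ≤ 2 * m
    two-fewer {c} {m} {k} c+[k+1-m]<k m≤k = ≤-trans (≤-reflexive (double c)) (*-monoʳ-≤ 2 c+2≤m)
      where
      double : ∀ c → suc (2 * c + 1) ≡ 2 * suc c
      double = solve-∀
      c+2≤m : suc c ≤ m
      c+2≤m = ≤-trans (n≤1+n (suc c)) (+-cancelʳ-≤ k (suc (suc c)) m (begin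
        suc (suc c) + k              ≡⟨ cong suc (sym (+-suc c k)) ⟩
        suc c + suc k                ≡⟨ cong (suc c +_) (sym (m∸n+n≡m (≤-trans m≤k (n≤1+n k)))) ⟩
        suc c + ((suc k ∸ m) + m)    ≡⟨ sym (+-assoc (suc c) (suc k ∸ m) m) ⟩
        suc (c + (suc k ∸ m)) + m    ≤⟨ +-monoˡ-≤ m c+[k+1-m]<k ⟩
        k + m                        ≡⟨ +-comm k m ⟩
        m + k                        ∎))
        where open ≤-Reasoning

    ∸≤pred : ∀ {c m k} → suc c ≡ k → 2 ≤ m → suc k ∸ m ≤ c
    ∸≤pred {c} refl 2≤m = ∸-monoʳ-≤ (suc (suc c)) 2≤m

    pred≤∸ : ∀ {c m k} → suc c ≡ k → m ≤ 1 → c ≤ suc k ∸ m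
    pred≤∸ {c} refl m≤1 = ≤-trans (n≤1+n c) (∸-monoʳ-≤ (suc (suc c)) m≤1)

  -- with m ≤ 1 every parallel is probed and no candidate survives; otherwise
  -- k + 1 - m parallels cover points of R, leaving at most m - 2 candidates
  pencil-progress : ∀ L y cd o → Invariant (lines-through L y) cd → Progress (lines-through L y) cd o
  pencil-progress L y cd o inv 2≤ = points-on-R , smaller (m ≤? 1)
    where
    open Round L y cd inv o
    B₀∈ : cd (ln B₀) ≡ true
    B₀∈ with 1≤count⇒∃ {f = cd'} (≤-trans (s≤s z≤n) 2≤)
    ... | w , p with update-from w p
    ...   | u , cu , _ with on-lines u cu
    ...     | B , refl = firstOr-satisfies some-line (candLns cd) cu
    open Nonempty B₀∈
    open Crowded 2≤
    points-on-R : Invariant (points-on R) cd'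
    points-on-R w p = let (x , e) = on-points w p in x , e , on-R x (subst (λ z → cd' z ≡ true) e p)
    smaller : Dec (m ≤ 1) → suc (2 * count cd' + 1) ≤ 2 * count cd
    smaller (yes m≤1) = ⊥-elim (n≮0 (≤-trans 2≤ (≤-reflexive none)))
      where
      all-probed : count Par ≡ count parallels
      all-probed = count-cong (takeFirst-all (suc k ∸ m) parallels (pred≤∸ count-parallels m≤1))
      none : count cd' ≡ 0
      none = no-room (subst (λ p → suc (count cd' + p) ≤ k) all-probed fewer) count-parallels
    smaller (no m≰1) rewrite count-lines cd on-lines =
      two-fewer (subst (λ p → suc (count cd' + p) ≤ k) some-probed fewer) m≤k
      where
      some-probed : count Par ≡ suc k ∸ m
      some-probed = count-takeFirst (suc k ∸ m) parallels (∸≤pred count-parallels (≰⇒> m≰1))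

module UpperBound {k : ℕ} (A : AffinePlane k) (3≤k : 3 ≤ k) where
  open Counting
  open CopStrategy A 3≤k
  open Distances A 2≤k
  open Tracking A 2≤k
  open PointsStep A 3≤k using (points-progress)
  open PencilStep A 3≤k using (pencil-progress)

  Knowledge : Set
  Knowledge = Mode × Candidates

  learn : Knowledge → Vec ℕ k → Knowledge
  learn (md , cd) o = let cd' = update (probes md cd) o cd in nextMode md cd' , cd'

  know : List (Vec ℕ k) → Knowledge
  know [] = start , everywhere
  know (o ∷ h) = learn (know h) o

  σ : Strategy N k
  σ h = probes (proj₁ (know h)) (proj₂ (know h))

  Started : Mode → Set
  Started start = ⊥
  Started _ = ⊤

  nextMode-started : ∀ md cd → Started (nextMode md cd)
  nextMode-started start cd with anyFin (candPts cd)
  ... | true = tt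
  ... | false = tt
  nextMode-started off-P cd with anyFin (candPts cd)
  ... | true = tt
  ... | false = tt
  nextMode-started (points-on L) cd = tt
  nextMode-started (lines-through L y) cd = tt

  progress : ∀ md cd o → Invariant md cd → Started md → Progress md cd o
  progress off-P cd o inv _ = off-P-progress cd o inv
  progress (points-on L) cd o inv _ = points-progress L cd o inv
  progress (lines-through L y) cd o inv _ = pencil-progress L y cd o inv

  module Play (w : RobberWalk G) where

    r : ℕ → V
    r = proj₁ w

    mode : ℕ → Mode
    mode t = proj₁ (know (history G σ r (suc t)))

    candidates : ℕ → Candidates
    candidates t = proj₂ (know (history G σ r (suc t)))

    robber-is-candidate : ∀ t → candidates t (r t) ≡ true
    robber-is-candidate zero = update-intro (σ []) everywhere (r 0) (r 0) refl (inj₁ refl)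
    robber-is-candidate (suc t) =
      update-intro (σ (history G σ r (suc t))) (candidates t) (r t) (r (suc t)) (robber-is-candidate t) (proj₂ w t)

    narrows-down : ∀ n t → potential (mode t) (candidates t) ≤ n → Invariant (mode t) (candidates t) →
      Started (mode t) → ∃ λ t' → count (candidates t') ≤ 1
    narrows-down n t bound inv started with count (candidates (suc t)) ≤? 1
    ... | yes done = suc t , done
    ... | no crowded with progress (mode t) (candidates t) _ inv started (≰⇒> crowded)
    ...   | inv' , drop with n
    ...     | zero = ⊥-elim (n≮0 (≤-trans drop bound))
    ...     | suc n' = narrows-down n' (suc t) (≤-pred (≤-trans drop bound)) inv' (nextMode-started (mode t) (candidates (suc t)))

    eventually-alone : ∃ λ t → count (candidates t) ≤ 1
    eventually-alone with count (candidates 0) ≤? 1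
    ... | yes done = 0 , done
    ... | no crowded = narrows-down _ 0 ≤-refl (start-step _ (≰⇒> crowded)) (nextMode-started start (candidates 0))

  located : ∀ (w : RobberWalk G) t → count (Play.candidates w t) ≤ 1 → Located G σ w t
  located w t alone w' same-history = count≤1⇒unique _ alone (proj₁ w' t) (proj₁ w t)
    (subst (λ h → proj₂ (know h) (proj₁ w' t) ≡ true) same-history (Play.robber-is-candidate w' t))
    (Play.robber-is-candidate w t)

  upper-bound : CopsWin G k
  upper-bound = σ , λ w → let (t , alone) = Play.eventually-alone w in t , located w t alone

theorem3p5 : (k : ℕ) → 3 ≤ k → (A : AffinePlane k) →
    ZetaIs (IncidenceGraph A) k
theorem3p5 k 3≤k A = UpperBound.upper-bound A 3≤k , LowerBound.lower-bound A (≤-trans (n≤1+n 2) 3≤k)
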